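{- Let $\omega=(-1+\sqrt{ -3})/2$. For every positive integer $m$ and every odd integer $n\ge 3$, $$\sum_{\substack{0\le k\le n\\ 6\mid k-3}}\binom nkm^kB_{n-k}=\frac n3\Big\{\sum_{r=1}^{m-1}r^{n-1}-\sum_{r=1}^{\lfloor (m-1)/2\rfloor}\big((r+m\omega)^{n-1}+(r+m\omega^2)^{n-1}\big)+\delta(m,n)\Big\},$$ where $$\delta(m,n)=\begin{cases} -\frac 12m^{n-1}&\text{if $m$ is odd and $3\mid n-1$,}\\ m^{n-1}&\text{if $m$ is odd and $3\nmid n-1$,}\\ -\frac 12m^{n-1}-(-3)^{\frac{n-1}2}(m/2)^{n-1}&\text{if $m$ is even and $3\mid n-1$,}\\ m^{n-1}-(-3)^{\frac{n-1}2}(m/2)^{n-1}&\text{if $m$ is even and $3\nmid n-1$.}\end{cases}$$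
   Context: The Bernoulli numbers $B_n$ are defined by $B_0=1$ and $\sum_{k=0}^{n-1}\binom nkB_k=0$ for $n\ge 2$. $\lfloor y\rfloor$ denotes the greatest integer not exceeding $y$. -}

module Defs where

open import Data.Nat as ℕ using (ℕ; zero; suc; _%_)
open import Data.Nat.Combinatorics using (_C_)
open import Data.Nat.Divisibility using (_∣?_)
open import Data.Integer as ℤ using (ℤ; +_)
open import Data.Rational as ℚ using (ℚ; 0ℚ; 1ℚ; _/_; _+_; _*_; _-_; -_)
open import Data.List using (List; upTo; map; foldr; filter)
open import Data.Vec as Vec using (Vec; _∷_; []; _∷ʳ_; lookup)
open import Data.Fin using (Fin; toℕ; fromℕ)
open import Relation.Nullary.Decidable using (does)
open import Data.Bool using (if_then_else_)

ℕ→ℚ : ℕ → ℚ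
ℕ→ℚ k = + k / 1

_^ℚ_ : ℚ → ℕ → ℚ
x ^ℚ zero = 1ℚ
x ^ℚ suc k = x * (x ^ℚ k)

Σ< : ℕ → (ℕ → ℚ) → ℚ
Σ< zero f = 0ℚ
Σ< (suc n) f = Σ< n f + f n

-- Bernoulli numbers: B₀ = 1 and Σ_{k=0}^{n-1} C(n,k) B_k = 0 for n ≥ 2,
-- i.e. B_{m} = -(1/(m+1)) Σ_{k=0}^{m-1} C(m+1,k) B_k for m ≥ 1.
bernVec : (n : ℕ) → Vec ℚ (suc n)
bernVec zero = 1ℚ ∷ []
bernVec (suc m) = prev ∷ʳ next
  where
  prev : Vec ℚ (suc m)
  prev = bernVec m
  sumFin : (j : ℕ) → Vec ℚ j → ℚ
  sumFin j v = Vec.foldr _ _+_ 0ℚ (Vec.zipWith (λ k b → ℕ→ℚ ((suc (suc m)) C k) * b) (Vec.map toℕ (Vec.allFin j)) v)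
  next : ℚ
  next = - ((+ 1 / suc (suc m)) * sumFin (suc m) prev)

bernoulli : ℕ → ℚ
bernoulli n = lookup (bernVec n) (fromℕ n)

-- The field ℚ(ω), ω = (-1+√-3)/2, with elements a + b ω (ω² = -1 - ω)
record ℚω : Set where
  constructor mkω
  field
    re : ℚ
    im : ℚ
open ℚω public

embed : ℚ → ℚω
embed a = mkω a 0ℚ

_+ω_ : ℚω → ℚω → ℚω
mkω a b +ω mkω c d = mkω (a + c) (b + d)

-ω_ : ℚω → ℚω
-ω mkω a b = mkω (- a) (- b)

_*ω_ : ℚω → ℚω → ℚω
mkω a b *ω mkω c d = mkω ((a * c) - (b * d)) (((a * d) + (b * c)) - (b * d))

_^ω_ : ℚω → ℕ → ℚω
x ^ω zero = embed 1ℚ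
x ^ω suc k = x *ω (x ^ω k)

ω : ℚω
ω = mkω 0ℚ 1ℚ

ℕ→ℚω : ℕ → ℚω
ℕ→ℚω k = embed (ℕ→ℚ k)

-- left-hand side: Σ_{0 ≤ k ≤ n, 6 ∣ k - 3} C(n,k) m^k B_{n-k}
-- (6 ∣ k - 3 for a natural k is k mod 6 = 3)
lhs : ℕ → ℕ → ℚ
lhs m n = Σ< (suc n) (λ k →
  if does (k % 6 ℕ.≟ 3)
  then ℕ→ℚ (n C k) * (ℕ→ℚ m ^ℚ k) * bernoulli (n ℕ.∸ k)
  else 0ℚ)

δ : ℕ → ℕ → ℚ
δ m n =
  (if does (3 ∣? (n ℕ.∸ 1))
   then - ((+ 1 / 2) * (ℕ→ℚ m ^ℚ (n ℕ.∸ 1)))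
   else ℕ→ℚ m ^ℚ (n ℕ.∸ 1))
  - (if does (m % 2 ℕ.≟ 1)
     then 0ℚ
     else ((ℤ.- (+ 3) / 1) ^ℚ ((n ℕ.∸ 1) ℕ./ 2)) * ((+ m / 2) ^ℚ (n ℕ.∸ 1)))

rhs : ℕ → ℕ → ℚω
rhs m n = embed (+ n / 3) *ω
  ( ( embed (Σ< m (λ r → if does (r ℕ.≟ 0) then 0ℚ else ℕ→ℚ r ^ℚ (n ℕ.∸ 1)))
    +ω (-ω sumω ((m ℕ.∸ 1) ℕ./ 2)))
    +ω embed (δ m n))
  where
  term : ℕ → ℚω
  term r = ((ℕ→ℚω r +ω (ℕ→ℚω m *ω ω)) ^ω (n ℕ.∸ 1))
        +ω ((ℕ→ℚω r +ω (ℕ→ℚω m *ω (ω *ω ω))) ^ω (n ℕ.∸ 1))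
  sumω : ℕ → ℚω
  sumω zero = embed 0ℚ
  sumω (suc K) = sumω K +ω term (suc K)

-- Let P n x = Σ_k C(n,k) B_{n-k} x^k be the Bernoulli polynomial.  The left-hand side is the
-- sixth-roots-of-unity filter (1/6) Σ_ε ±P n (m ε) applied to P n at m.  For odd n ≥ 3 one has
-- B_n = 0, P n (x + 1) = P n x + n x^(n-1) and P n (-x) = -P n x - n x^(n-1); these reduce the six
-- values to the power sums Σ_{r<m} r^(n-1) and Σ_{r<m} (r + mω)^(n-1).  Since m - r + mω = -(r + mω²)
-- and n - 1 is even, pairing r with m - r folds the second sum into the sum over 1 ≤ r ≤ ⌊(m-1)/2⌋;
-- the unpaired term r = m/2 for even m and the values ζ^(n-1), ω^(n-1) (ζ = 1 + ω) make up δ(m,n).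
-- B_n = 0 for odd n ≥ 3 because (-1)^i B_i - [i = 1] satisfies the recurrence defining the B_i.

module Submission where

open import Defs
open import Relation.Binary.PropositionalEquality
open import Algebra.Bundles using (CommutativeRing)
open import Algebra.Structures {A = ℚω} _≡_ using (IsCommutativeRing)
import Algebra.Solver.Ring.AlmostCommutativeRing as ACR
import Algebra.Solver.Ring.Simple as RingSolver
open import Data.Bool using (true; false; if_then_else_)
open import Data.Empty using (⊥-elim)
open import Data.Fin using (toℕ; fromℕ)
import Data.Integer as ℤ
import Data.Integer.Properties as ℤP
import Data.Integer.Solver as ℤ-Solver
open import Data.Nat as ℕ using (ℕ; zero; suc; _≤_; _<_; z≤n; s≤s; _∸_; _%_; _!)
import Data.Nat.Properties as ℕP
open import Data.Nat.Combinatorics using (_C_; nCk+nC[k+1]≡[n+1]C[k+1]; nCk≡nC[n∸k]; nC1≡n; nCn≡1; k![n∸k]!∣n!)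
open import Data.Nat.Combinatorics.Specification using (nCk≡n!/k![n-k]!; k>n⇒nCk≡0)
open import Data.Nat.DivMod using (m/n*n≡m; m*n/n≡m; m*n%n≡0; [m+kn]%n≡m%n; +-distrib-/-∣ʳ)
open import Data.Nat.Divisibility using (_∣?_; divides-refl)
import Data.Nat.Solver as ℕ-Solver
open import Data.Product using (_,_)
open import Data.Sum using ([_,_]′)
open import Data.Rational as ℚ using (ℚ; 0ℚ; 1ℚ; _/_; toℚᵘ)
import Data.Rational.Properties as ℚP
import Data.Rational.Solver as ℚ-Solver
open import Data.Rational.Unnormalised as ℚᵘ using (mkℚᵘ; *≡*)
import Data.Rational.Unnormalised.Properties as ℚᵘP
open import Data.Vec as Vec using (Vec; _∷_; []; _∷ʳ_; lookup; tabulate)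
import Data.Vec.Properties as VecP
open import Function using (_∘_)
open import Relation.Binary.Definitions using (DecidableEquality)
open import Relation.Nullary using (yes; no)
open import Relation.Nullary.Decidable using (does)

private
  module ℚω-Laws where
    open ℚ-Solver.+-*-Solver

    +ω-assoc : ∀ x y z → (x +ω y) +ω z ≡ x +ω (y +ω z)
    +ω-assoc (mkω a b) (mkω c d) (mkω e f) = cong₂ mkω (ℚP.+-assoc a c e) (ℚP.+-assoc b d f)

    +ω-comm : ∀ x y → x +ω y ≡ y +ω x
    +ω-comm (mkω a b) (mkω c d) = cong₂ mkω (ℚP.+-comm a c) (ℚP.+-comm b d)

    +ω-identityˡ : ∀ x → embed 0ℚ +ω x ≡ x
    +ω-identityˡ (mkω a b) = cong₂ mkω (ℚP.+-identityˡ a) (ℚP.+-identityˡ b)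

    +ω-identityʳ : ∀ x → x +ω embed 0ℚ ≡ x
    +ω-identityʳ (mkω a b) = cong₂ mkω (ℚP.+-identityʳ a) (ℚP.+-identityʳ b)

    -ω-inverseˡ : ∀ x → (-ω x) +ω x ≡ embed 0ℚ
    -ω-inverseˡ (mkω a b) = cong₂ mkω (ℚP.+-inverseˡ a) (ℚP.+-inverseˡ b)

    -ω-inverseʳ : ∀ x → x +ω (-ω x) ≡ embed 0ℚ
    -ω-inverseʳ (mkω a b) = cong₂ mkω (ℚP.+-inverseʳ a) (ℚP.+-inverseʳ b)

    *ω-assoc : ∀ x y z → (x *ω y) *ω z ≡ x *ω (y *ω z)
    *ω-assoc (mkω a b) (mkω c d) (mkω e f) = cong₂ mkω
      (solve 6 (λ a b c d e f → ((a :* c :- b :* d) :* e) :- ((a :* d :+ b :* c :- b :* d) :* f)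
                              := (a :* (c :* e :- d :* f)) :- (b :* (c :* f :+ d :* e :- d :* f))) refl a b c d e f)
      (solve 6 (λ a b c d e f → ((a :* c :- b :* d) :* f :+ (a :* d :+ b :* c :- b :* d) :* e) :- ((a :* d :+ b :* c :- b :* d) :* f)
                              := (a :* (c :* f :+ d :* e :- d :* f) :+ b :* (c :* e :- d :* f)) :- (b :* (c :* f :+ d :* e :- d :* f))) refl a b c d e f)

    *ω-comm : ∀ x y → x *ω y ≡ y *ω x
    *ω-comm (mkω a b) (mkω c d) = cong₂ mkω
      (solve 4 (λ a b c d → a :* c :- b :* d := c :* a :- d :* b) refl a b c d)
      (solve 4 (λ a b c d → a :* d :+ b :* c :- b :* d := c :* b :+ d :* a :- d :* b) refl a b c d)

    *ω-identityˡ : ∀ x → embed 1ℚ *ω x ≡ x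
    *ω-identityˡ (mkω a b) = cong₂ mkω
      (solve 2 (λ a b → con 1ℚ :* a :- con 0ℚ :* b := a) refl a b)
      (solve 2 (λ a b → con 1ℚ :* b :+ con 0ℚ :* a :- con 0ℚ :* b := b) refl a b)

    *ω-identityʳ : ∀ x → x *ω embed 1ℚ ≡ x
    *ω-identityʳ x = trans (*ω-comm x (embed 1ℚ)) (*ω-identityˡ x)

    *ω-distribˡ : ∀ x y z → x *ω (y +ω z) ≡ (x *ω y) +ω (x *ω z)
    *ω-distribˡ (mkω a b) (mkω c d) (mkω e f) = cong₂ mkω
      (solve 6 (λ a b c d e f → a :* (c :+ e) :- b :* (d :+ f) := (a :* c :- b :* d) :+ (a :* e :- b :* f)) refl a b c d e f)
      (solve 6 (λ a b c d e f → a :* (d :+ f) :+ b :* (c :+ e) :- b :* (d :+ f)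
                              := (a :* d :+ b :* c :- b :* d) :+ (a :* f :+ b :* e :- b :* f)) refl a b c d e f)

    *ω-distribʳ : ∀ x y z → (y +ω z) *ω x ≡ (y *ω x) +ω (z *ω x)
    *ω-distribʳ x y z = trans (*ω-comm (y +ω z) x) (trans (*ω-distribˡ x y z) (cong₂ _+ω_ (*ω-comm x y) (*ω-comm x z)))

ℚω-isCommutativeRing : IsCommutativeRing _+ω_ _*ω_ -ω_ (embed 0ℚ) (embed 1ℚ)
ℚω-isCommutativeRing = record
  { isRing = record
    { +-isAbelianGroup = record
      { isGroup = record
        { isMonoid = record
          { isSemigroup = record
            { isMagma = record { isEquivalence = isEquivalence ; ∙-cong = cong₂ _+ω_ }
            ; assoc = +ω-assoc }
          ; identity = +ω-identityˡ , +ω-identityʳ }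
        ; inverse = -ω-inverseˡ , -ω-inverseʳ
        ; ⁻¹-cong = cong -ω_ }
      ; comm = +ω-comm }
    ; *-cong = cong₂ _*ω_
    ; *-assoc = *ω-assoc
    ; *-identity = *ω-identityˡ , *ω-identityʳ
    ; distrib = *ω-distribˡ , *ω-distribʳ }
  ; *-comm = *ω-comm }
  where open ℚω-Laws

ℚω-commutativeRing : CommutativeRing _ _
ℚω-commutativeRing = record { isCommutativeRing = ℚω-isCommutativeRing }

open CommutativeRing ℚω-commutativeRing
  using (_+_; _*_; -_; _-_; 0#; 1#; +-identityˡ; +-identityʳ; *-identityˡ; *-identityʳ; *-assoc; *-comm; +-comm; +-assoc; distribˡ)

_≟ω_ : DecidableEquality ℚω
mkω a b ≟ω mkω c d with a ℚP.≟ c | b ℚP.≟ d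
... | yes refl | yes refl = yes refl
... | no a≢c   | _        = no λ { refl → a≢c refl }
... | _        | no b≢d   = no λ { refl → b≢d refl }

-- The solver evaluates closed coefficients, so identities such as 1 + ω = -ω² and ζ = 1 + ω are within its reach.
module ℚω-Solver = RingSolver (ACR.fromCommutativeRing ℚω-commutativeRing) _≟ω_

open ℚω-Solver using (solve; _:+_; _:*_; :-_; _:-_; _:=_; con)

toℚᵘ-/ : ∀ a d → toℚᵘ (ℤ.+ a / suc d) ℚᵘ.≃ mkℚᵘ (ℤ.+ a) d
toℚᵘ-/ a d = ℚP.toℚᵘ-fromℚᵘ (mkℚᵘ (ℤ.+ a) d)

ℕ→ℚ-+ : ∀ a b → ℕ→ℚ (a ℕ.+ b) ≡ ℕ→ℚ a ℚ.+ ℕ→ℚ b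
ℕ→ℚ-+ a b = ℚP.toℚᵘ-injective (begin
  toℚᵘ (ℕ→ℚ (a ℕ.+ b))                ≈⟨ toℚᵘ-/ (a ℕ.+ b) 0 ⟩
  mkℚᵘ (ℤ.+ (a ℕ.+ b)) 0              ≈⟨ *≡* (cong (ℤ._* ℤ.+ 1) (sym (cong₂ ℤ._+_ (ℤP.*-identityʳ (ℤ.+ a)) (ℤP.*-identityʳ (ℤ.+ b))))) ⟩
  mkℚᵘ (ℤ.+ a) 0 ℚᵘ.+ mkℚᵘ (ℤ.+ b) 0  ≈⟨ ℚᵘP.+-cong (toℚᵘ-/ a 0) (toℚᵘ-/ b 0) ⟨
  toℚᵘ (ℕ→ℚ a) ℚᵘ.+ toℚᵘ (ℕ→ℚ b)      ≈⟨ ℚP.toℚᵘ-homo-+ (ℕ→ℚ a) (ℕ→ℚ b) ⟨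
  toℚᵘ (ℕ→ℚ a ℚ.+ ℕ→ℚ b)              ∎)
  where
  open ℚᵘP.≃-Reasoning

ℕ→ℚ-* : ∀ a b → ℕ→ℚ (a ℕ.* b) ≡ ℕ→ℚ a ℚ.* ℕ→ℚ b
ℕ→ℚ-* a b = ℚP.toℚᵘ-injective (begin
  toℚᵘ (ℕ→ℚ (a ℕ.* b))                ≈⟨ toℚᵘ-/ (a ℕ.* b) 0 ⟩
  mkℚᵘ (ℤ.+ (a ℕ.* b)) 0              ≈⟨ *≡* (cong (ℤ._* ℤ.+ 1) (ℤP.pos-* a b)) ⟩
  mkℚᵘ (ℤ.+ a) 0 ℚᵘ.* mkℚᵘ (ℤ.+ b) 0  ≈⟨ ℚᵘP.*-cong (toℚᵘ-/ a 0) (toℚᵘ-/ b 0) ⟨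
  toℚᵘ (ℕ→ℚ a) ℚᵘ.* toℚᵘ (ℕ→ℚ b)      ≈⟨ ℚP.toℚᵘ-homo-* (ℕ→ℚ a) (ℕ→ℚ b) ⟨
  toℚᵘ (ℕ→ℚ a ℚ.* ℕ→ℚ b)              ∎)
  where
  open ℚᵘP.≃-Reasoning

n/d≡n*[1/d] : ∀ n d → ℤ.+ n / suc d ≡ ℕ→ℚ n ℚ.* (ℤ.+ 1 / suc d)
n/d≡n*[1/d] n d = ℚP.toℚᵘ-injective (begin
  toℚᵘ (ℤ.+ n / suc d)                    ≈⟨ toℚᵘ-/ n d ⟩
  mkℚᵘ (ℤ.+ n) d                          ≈⟨ *≡* (ℤS.solve 2 (λ x y → x ℤS.:* (ℤS.con (ℤ.+ 1) ℤS.:* y) ℤS.:= (x ℤS.:* ℤS.con (ℤ.+ 1)) ℤS.:* y) refl (ℤ.+ n) (ℤ.+ suc d)) ⟩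
  mkℚᵘ (ℤ.+ n) 0 ℚᵘ.* mkℚᵘ (ℤ.+ 1) d      ≈⟨ ℚᵘP.*-cong (toℚᵘ-/ n 0) (toℚᵘ-/ 1 d) ⟨
  toℚᵘ (ℕ→ℚ n) ℚᵘ.* toℚᵘ (ℤ.+ 1 / suc d)  ≈⟨ ℚP.toℚᵘ-homo-* (ℕ→ℚ n) (ℤ.+ 1 / suc d) ⟨
  toℚᵘ (ℕ→ℚ n ℚ.* (ℤ.+ 1 / suc d))        ∎)
  where
  open ℚᵘP.≃-Reasoning
  module ℤS = ℤ-Solver.+-*-Solver

n*[1/n]≡1 : ∀ d → ℕ→ℚ (suc d) ℚ.* (ℤ.+ 1 / suc d) ≡ 1ℚ
n*[1/n]≡1 d = trans (sym (n/d≡n*[1/d] (suc d) d)) (ℚP.toℚᵘ-injective (ℚᵘP.≃-trans (toℚᵘ-/ (suc d) d) (*≡* (ℤP.*-comm (ℤ.+ suc d) (ℤ.+ 1)))))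

embed-* : ∀ a b → embed (a ℚ.* b) ≡ embed a * embed b
embed-* a b = cong₂ mkω
  (Q.solve 2 (λ a b → a Q.:* b Q.:= (a Q.:* b) Q.:- (Q.con 0ℚ Q.:* Q.con 0ℚ)) refl a b)
  (Q.solve 2 (λ a b → Q.con 0ℚ Q.:= ((a Q.:* Q.con 0ℚ) Q.:+ (Q.con 0ℚ Q.:* b)) Q.:- (Q.con 0ℚ Q.:* Q.con 0ℚ)) refl a b)
  where module Q = ℚ-Solver.+-*-Solver

embed-^ : ∀ a k → embed (a ^ℚ k) ≡ embed a ^ω k
embed-^ a zero    = refl
embed-^ a (suc k) = trans (embed-* a (a ^ℚ k)) (cong (embed a *_) (embed-^ a k))

ℕ→ℚω-+ : ∀ a b → ℕ→ℚω (a ℕ.+ b) ≡ ℕ→ℚω a + ℕ→ℚω b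
ℕ→ℚω-+ a b = cong embed (ℕ→ℚ-+ a b)

ℕ→ℚω-* : ∀ a b → ℕ→ℚω (a ℕ.* b) ≡ ℕ→ℚω a * ℕ→ℚω b
ℕ→ℚω-* a b = trans (cong embed (ℕ→ℚ-* a b)) (embed-* (ℕ→ℚ a) (ℕ→ℚ b))

ℕ→ℚω-∸ : ∀ {k m} → k ≤ m → ℕ→ℚω (m ∸ k) ≡ ℕ→ℚω m - ℕ→ℚω k
ℕ→ℚω-∸ {k} {m} k≤m = begin
  ℕ→ℚω (m ∸ k)                          ≡⟨ solve 2 (λ a b → a := (b :+ a) :- b) refl (ℕ→ℚω (m ∸ k)) (ℕ→ℚω k) ⟩
  (ℕ→ℚω k + ℕ→ℚω (m ∸ k)) - ℕ→ℚω k      ≡⟨ cong (_- ℕ→ℚω k) (ℕ→ℚω-+ k (m ∸ k)) ⟨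
  ℕ→ℚω (k ℕ.+ (m ∸ k)) - ℕ→ℚω k         ≡⟨ cong (λ z → ℕ→ℚω z - ℕ→ℚω k) (ℕP.m+[n∸m]≡n k≤m) ⟩
  ℕ→ℚω m - ℕ→ℚω k                       ∎
  where open ≡-Reasoning

ℕ→ℚω-inverse : ∀ d → ℕ→ℚω (suc d) * embed (ℤ.+ 1 / suc d) ≡ 1#
ℕ→ℚω-inverse d = trans (sym (embed-* (ℕ→ℚ (suc d)) (ℤ.+ 1 / suc d))) (cong embed (n*[1/n]≡1 d))

ℕ→ℚω-cancelˡ : ∀ d {x y} → ℕ→ℚω (suc d) * x ≡ ℕ→ℚω (suc d) * y → x ≡ y
ℕ→ℚω-cancelˡ d {x} {y} eq = begin
  x              ≡⟨ *-identityˡ x ⟨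
  1# * x         ≡⟨ cong (_* x) (ℕ→ℚω-inverse d) ⟨
  n * i * x      ≡⟨ solve 3 (λ n i x → n :* i :* x := i :* (n :* x)) refl n i x ⟩
  i * (n * x)    ≡⟨ cong (i *_) eq ⟩
  i * (n * y)    ≡⟨ solve 3 (λ n i y → i :* (n :* y) := n :* i :* y) refl n i y ⟩
  n * i * y      ≡⟨ cong (_* y) (ℕ→ℚω-inverse d) ⟩
  1# * y         ≡⟨ *-identityˡ y ⟩
  y              ∎
  where
  open ≡-Reasoning
  n = ℕ→ℚω (suc d)
  i = embed (ℤ.+ 1 / suc d)

data Parity : ℕ → Set where
  even : ∀ j → Parity (j ℕ.+ j)
  odd  : ∀ j → Parity (suc (j ℕ.+ j))

parity : ∀ n → Parity n
parity zero = even 0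
parity (suc n) with parity n
... | even j = odd j
... | odd j  = subst Parity (cong suc (ℕP.+-suc j j)) (even (suc j))

j+j≡j*2 : ∀ j → j ℕ.+ j ≡ j ℕ.* 2
j+j≡j*2 j = trans (cong (j ℕ.+_) (sym (ℕP.+-identityʳ j))) (ℕP.*-comm 2 j)

[j+j]/2≡j : ∀ j → (j ℕ.+ j) ℕ./ 2 ≡ j
[j+j]/2≡j j = trans (cong (ℕ._/ 2) (j+j≡j*2 j)) (m*n/n≡m j 2)

[1+j+j]/2≡j : ∀ j → suc (j ℕ.+ j) ℕ./ 2 ≡ j
[1+j+j]/2≡j j = trans (cong (λ z → suc z ℕ./ 2) (j+j≡j*2 j)) (trans (+-distrib-/-∣ʳ 1 {d = 2} (divides-refl j)) (m*n/n≡m j 2))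

[j+j]%2≡0 : ∀ j → (j ℕ.+ j) % 2 ≡ 0
[j+j]%2≡0 j = trans (cong (_% 2) (j+j≡j*2 j)) (m*n%n≡0 j 2)

[1+j+j]%2≡1 : ∀ j → suc (j ℕ.+ j) % 2 ≡ 1
[1+j+j]%2≡1 j = trans (cong (λ z → suc z % 2) (j+j≡j*2 j)) ([m+kn]%n≡m%n 1 j 2)

m+m<n+n⇒m<n : ∀ m n → m ℕ.+ m < n ℕ.+ n → m < n
m+m<n+n⇒m<n m n lt = ℕP.≰⇒> (λ n≤m → ℕP.<⇒≱ lt (ℕP.+-mono-≤ n≤m n≤m))

[1+2j]∸2i≡1+2[j∸i] : ∀ {i j} → i ≤ j → suc (j ℕ.+ j) ∸ (i ℕ.+ i) ≡ suc ((j ∸ i) ℕ.+ (j ∸ i))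
[1+2j]∸2i≡1+2[j∸i] {i} {j} i≤j = begin
  suc (j ℕ.+ j) ∸ (i ℕ.+ i)                    ≡⟨ cong (λ z → suc (z ℕ.+ z) ∸ (i ℕ.+ i)) (ℕP.m+[n∸m]≡n i≤j) ⟨
  suc ((i ℕ.+ d) ℕ.+ (i ℕ.+ d)) ∸ (i ℕ.+ i)    ≡⟨ cong (_∸ (i ℕ.+ i)) (ℕS.solve 2 (λ i d → ℕS.con 1 ℕS.:+ ((i ℕS.:+ d) ℕS.:+ (i ℕS.:+ d))
                                                                          ℕS.:= (i ℕS.:+ i) ℕS.:+ (ℕS.con 1 ℕS.:+ (d ℕS.:+ d))) refl i d) ⟩
  (i ℕ.+ i) ℕ.+ suc (d ℕ.+ d) ∸ (i ℕ.+ i)      ≡⟨ ℕP.m+n∸m≡n (i ℕ.+ i) _ ⟩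
  suc (d ℕ.+ d)                                ∎
  where
  open ≡-Reasoning
  module ℕS = ℕ-Solver.+-*-Solver
  d = j ∸ i

[K+K]∸[K∸[1+j]]≡1+K+j : ∀ K j → j < K → (K ℕ.+ K) ∸ (K ∸ suc j) ≡ suc (K ℕ.+ j)
[K+K]∸[K∸[1+j]]≡1+K+j K j j<K = begin
  (K ℕ.+ K) ∸ d                                 ≡⟨ cong (λ z → (z ℕ.+ z) ∸ d) (ℕP.m+[n∸m]≡n j<K) ⟨
  ((suc j ℕ.+ d) ℕ.+ (suc j ℕ.+ d)) ∸ d         ≡⟨ cong (_∸ d) (ℕS.solve 2 (λ j d → (ℕS.con 1 ℕS.:+ j ℕS.:+ d) ℕS.:+ (ℕS.con 1 ℕS.:+ j ℕS.:+ d)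
                                                                          ℕS.:= (ℕS.con 1 ℕS.:+ j ℕS.:+ (ℕS.con 1 ℕS.:+ j ℕS.:+ d)) ℕS.:+ d) refl j d) ⟩
  ((suc j ℕ.+ (suc j ℕ.+ d)) ℕ.+ d) ∸ d         ≡⟨ ℕP.m+n∸n≡m (suc j ℕ.+ (suc j ℕ.+ d)) d ⟩
  suc j ℕ.+ (suc j ℕ.+ d)                       ≡⟨ cong (λ z → suc (j ℕ.+ z)) (ℕP.m+[n∸m]≡n j<K) ⟩
  suc (j ℕ.+ K)                                 ≡⟨ cong suc (ℕP.+-comm j K) ⟩
  suc (K ℕ.+ j)                                 ∎
  where
  open ≡-Reasoning
  module ℕS = ℕ-Solver.+-*-Solver
  d = K ∸ suc j

^ω-distribˡ-+-* : ∀ x a b → x ^ω (a ℕ.+ b) ≡ x ^ω a * x ^ω b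
^ω-distribˡ-+-* x zero    b = sym (*-identityˡ _)
^ω-distribˡ-+-* x (suc a) b = trans (cong (x *_) (^ω-distribˡ-+-* x a b)) (sym (*-assoc x _ _))

^ω-distribʳ-* : ∀ x y k → (x * y) ^ω k ≡ x ^ω k * y ^ω k
^ω-distribʳ-* x y zero    = refl
^ω-distribʳ-* x y (suc k) = trans (cong (x * y *_) (^ω-distribʳ-* x y k))
  (solve 4 (λ x y a b → (x :* y) :* (a :* b) := (x :* a) :* (y :* b)) refl x y (x ^ω k) (y ^ω k))

^ω-zeroˡ : ∀ k → 0# ^ω suc k ≡ 0#
^ω-zeroˡ k = solve 1 (λ a → con 0# :* a := con 0#) refl (0# ^ω k)

^ω-neg : ∀ x k → (- x) ^ω k ≡ (- 1#) ^ω k * x ^ω k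
^ω-neg x k = trans (cong (_^ω k) (solve 1 (λ x → :- x := :- con 1# :* x) refl x)) (^ω-distribʳ-* (- 1#) x k)

[-1]^k*[-1]^k≡1 : ∀ k → (- 1#) ^ω k * (- 1#) ^ω k ≡ 1#
[-1]^k*[-1]^k≡1 zero    = refl
[-1]^k*[-1]^k≡1 (suc k) = trans (solve 1 (λ p → (:- con 1# :* p) :* (:- con 1# :* p) := p :* p) refl ((- 1#) ^ω k)) ([-1]^k*[-1]^k≡1 k)

[-1]^[j+j]≡1 : ∀ j → (- 1#) ^ω (j ℕ.+ j) ≡ 1#
[-1]^[j+j]≡1 j = trans (^ω-distribˡ-+-* (- 1#) j j) ([-1]^k*[-1]^k≡1 j)

[-1]^[1+j+j]≡-1 : ∀ j → (- 1#) ^ω suc (j ℕ.+ j) ≡ - 1#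
[-1]^[1+j+j]≡-1 j = trans (cong (- 1# *_) ([-1]^[j+j]≡1 j)) (*-identityʳ (- 1#))

-- Finite sums

Σω : ℕ → (ℕ → ℚω) → ℚω
Σω zero    f = 0#
Σω (suc n) f = Σω n f + f n

Σω-cong : ∀ n {f g : ℕ → ℚω} → (∀ k → k < n → f k ≡ g k) → Σω n f ≡ Σω n g
Σω-cong zero    f≗g = refl
Σω-cong (suc n) f≗g = cong₂ _+_ (Σω-cong n (λ k k<n → f≗g k (ℕP.m<n⇒m<1+n k<n))) (f≗g n ℕP.≤-refl)

Σω-zero : ∀ n {f : ℕ → ℚω} → (∀ k → k < n → f k ≡ 0#) → Σω n f ≡ 0#
Σω-zero n {f} f≗0 = trans (Σω-cong n f≗0) (zeros n)
  where
  zeros : ∀ n → Σω n (λ _ → 0#) ≡ 0#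
  zeros zero    = refl
  zeros (suc n) = trans (cong (_+ 0#) (zeros n)) (+-identityʳ 0#)

Σω-+ : ∀ n (f g : ℕ → ℚω) → Σω n (λ k → f k + g k) ≡ Σω n f + Σω n g
Σω-+ zero    f g = sym (+-identityˡ 0#)
Σω-+ (suc n) f g = trans (cong (_+ (f n + g n)) (Σω-+ n f g))
  (solve 4 (λ a b c d → (a :+ b) :+ (c :+ d) := (a :+ c) :+ (b :+ d)) refl (Σω n f) (Σω n g) (f n) (g n))

Σω-*ˡ : ∀ n c (f : ℕ → ℚω) → Σω n (λ k → c * f k) ≡ c * Σω n f
Σω-*ˡ zero    c f = solve 1 (λ c → con 0# := c :* con 0#) refl c
Σω-*ˡ (suc n) c f = trans (cong (_+ c * f n) (Σω-*ˡ n c f)) (sym (distribˡ c _ _))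

Σω-neg : ∀ n (f : ℕ → ℚω) → Σω n (λ k → - f k) ≡ - Σω n f
Σω-neg zero    f = refl
Σω-neg (suc n) f = trans (cong (_+ - f n) (Σω-neg n f))
  (solve 2 (λ a b → :- a :+ :- b := :- (a :+ b)) refl (Σω n f) (f n))

Σω-difference : ∀ N (f g : ℕ → ℚω) → Σω N (λ k → f k - g k) ≡ Σω N f - Σω N g
Σω-difference N f g = trans (Σω-+ N f (λ k → - g k)) (cong (Σω N f +_) (Σω-neg N g))

Σω-sucˡ : ∀ n (f : ℕ → ℚω) → Σω (suc n) f ≡ f 0 + Σω n (λ k → f (suc k))
Σω-sucˡ zero    f = trans (+-identityˡ (f 0)) (sym (+-identityʳ (f 0)))
Σω-sucˡ (suc n) f = trans (cong (_+ f (suc n)) (Σω-sucˡ n f)) (+-assoc (f 0) _ (f (suc n)))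

Σω-split : ∀ a b (f : ℕ → ℚω) → Σω (a ℕ.+ b) f ≡ Σω a f + Σω b (λ k → f (a ℕ.+ k))
Σω-split a zero    f = trans (cong (λ z → Σω z f) (ℕP.+-identityʳ a)) (sym (+-identityʳ _))
Σω-split a (suc b) f = begin
  Σω (a ℕ.+ suc b) f                                    ≡⟨ cong (λ z → Σω z f) (ℕP.+-suc a b) ⟩
  Σω (a ℕ.+ b) f + f (a ℕ.+ b)                          ≡⟨ cong (_+ f (a ℕ.+ b)) (Σω-split a b f) ⟩
  Σω a f + Σω b (λ k → f (a ℕ.+ k)) + f (a ℕ.+ b)       ≡⟨ +-assoc (Σω a f) _ _ ⟩
  Σω a f + Σω (suc b) (λ k → f (a ℕ.+ k))               ∎
  where open ≡-Reasoning

Σω-swap : ∀ n m (F : ℕ → ℕ → ℚω) → Σω n (λ i → Σω m (F i)) ≡ Σω m (λ j → Σω n (λ i → F i j))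
Σω-swap zero    m F = sym (Σω-zero m (λ _ _ → refl))
Σω-swap (suc n) m F = trans (cong (_+ Σω m (F n)) (Σω-swap n m F)) (sym (Σω-+ m (λ j → Σω n (λ i → F i j)) (F n)))

Σω-single : ∀ N a {g : ℕ → ℚω} → a < N → (∀ l → l < N → l ≢ a → g l ≡ 0#) → Σω N g ≡ g a
Σω-single (suc N) a {g} a<1+N g≗0 with a ℕ.≟ N
... | yes refl = trans (cong (_+ g a) (Σω-zero N (λ l l<N → g≗0 l (ℕP.m<n⇒m<1+n l<N) (ℕP.<⇒≢ l<N))))
                       (+-identityˡ _)
... | no a≢N   = trans (cong₂ _+_ (Σω-single N a (ℕP.≤∧≢⇒< (ℕP.≤-pred a<1+N) a≢N) (λ l l<N → g≗0 l (ℕP.m<n⇒m<1+n l<N)))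
                                   (g≗0 N ℕP.≤-refl (a≢N ∘ sym)))
                       (+-identityʳ _)

Σω-reverse : ∀ N (f : ℕ → ℚω) → Σω (suc N) f ≡ Σω (suc N) (λ k → f (N ∸ k))
Σω-reverse zero    f = refl
Σω-reverse (suc N) f = begin
  Σω (suc N) f + f (suc N)                         ≡⟨ cong (_+ f (suc N)) (Σω-reverse N f) ⟩
  Σω (suc N) (λ k → f (N ∸ k)) + f (suc N)         ≡⟨ +-comm _ (f (suc N)) ⟩
  f (suc N) + Σω (suc N) (λ k → f (N ∸ k))         ≡⟨ Σω-sucˡ (suc N) (λ k → f (suc N ∸ k)) ⟨
  Σω (suc (suc N)) (λ k → f (suc N ∸ k))           ∎
  where open ≡-Reasoning

Σω-reflect : ∀ K {f g : ℕ → ℚω} → (∀ j → j < K → f j ≡ g (K ∸ suc j)) → Σω K f ≡ Σω K g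
Σω-reflect zero    f≗g = refl
Σω-reflect (suc K) {f} {g} f≗g = trans (Σω-cong (suc K) f≗g) (sym (Σω-reverse K g))

Σω-fold-odd : ∀ K (h h′ : ℕ → ℚω) → (∀ r → r ≤ suc (K ℕ.+ K) → h (suc (K ℕ.+ K) ∸ r) ≡ h′ r) →
  Σω (suc (K ℕ.+ K)) h ≡ h 0 + Σω K (λ r → h (suc r) + h′ (suc r))
Σω-fold-odd K h h′ h≡h′ = begin
  Σω (suc (K ℕ.+ K)) h                                              ≡⟨ Σω-sucˡ (K ℕ.+ K) h ⟩
  h 0 + Σω (K ℕ.+ K) (h ∘ suc)                                      ≡⟨ cong (h 0 +_) (Σω-split K K (h ∘ suc)) ⟩
  h 0 + (Σω K (h ∘ suc) + Σω K (λ j → h (suc (K ℕ.+ j))))           ≡⟨ cong (λ z → h 0 + (Σω K (h ∘ suc) + z)) (Σω-reflect K mirror) ⟩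
  h 0 + (Σω K (h ∘ suc) + Σω K (h′ ∘ suc))                          ≡⟨ cong (h 0 +_) (Σω-+ K (h ∘ suc) (h′ ∘ suc)) ⟨
  h 0 + Σω K (λ r → h (suc r) + h′ (suc r))                         ∎
  where
  open ≡-Reasoning
  mirror : ∀ j → j < K → h (suc (K ℕ.+ j)) ≡ h′ (suc (K ∸ suc j))
  mirror j j<K = trans (cong h (sym ([K+K]∸[K∸[1+j]]≡1+K+j K j j<K)))
                       (h≡h′ (suc (K ∸ suc j)) (s≤s (ℕP.≤-trans (ℕP.m∸n≤m K (suc j)) (ℕP.m≤n+m K K))))

Σω-fold-even : ∀ K (h h′ : ℕ → ℚω) → (∀ r → r ≤ suc (suc (K ℕ.+ K)) → h (suc (suc (K ℕ.+ K)) ∸ r) ≡ h′ r) →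
  Σω (suc (suc (K ℕ.+ K))) h ≡ h 0 + Σω K (λ r → h (suc r) + h′ (suc r)) + h (suc K)
Σω-fold-even K h h′ h≡h′ = begin
  Σω (suc (suc (K ℕ.+ K))) h                                        ≡⟨ Σω-sucˡ (suc (K ℕ.+ K)) h ⟩
  h 0 + Σω (suc (K ℕ.+ K)) (h ∘ suc)                                ≡⟨ cong (λ z → h 0 + Σω z (h ∘ suc)) (ℕP.+-suc K K) ⟨
  h 0 + Σω (K ℕ.+ suc K) (h ∘ suc)                                  ≡⟨ cong (h 0 +_) (Σω-split K (suc K) (h ∘ suc)) ⟩
  h 0 + (A + Σω (suc K) (λ j → h (suc (K ℕ.+ j))))                  ≡⟨ cong (λ z → h 0 + (A + z)) (Σω-sucˡ K (λ j → h (suc (K ℕ.+ j)))) ⟩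
  h 0 + (A + (h (suc (K ℕ.+ 0)) + Σω K (λ j → h (suc (K ℕ.+ suc j)))))
                                                                    ≡⟨ cong₂ (λ z w → h 0 + (A + (h (suc z) + w))) (ℕP.+-identityʳ K) (Σω-reflect K mirror) ⟩
  h 0 + (A + (h (suc K) + B))                                       ≡⟨ solve 4 (λ x a m b → x :+ (a :+ (m :+ b)) := x :+ (a :+ b) :+ m) refl (h 0) A (h (suc K)) B ⟩
  h 0 + (A + B) + h (suc K)                                         ≡⟨ cong (λ z → h 0 + z + h (suc K)) (Σω-+ K (h ∘ suc) (h′ ∘ suc)) ⟨
  h 0 + Σω K (λ r → h (suc r) + h′ (suc r)) + h (suc K)             ∎
  where
  open ≡-Reasoning
  A = Σω K (h ∘ suc)
  B = Σω K (h′ ∘ suc)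
  mirror : ∀ j → j < K → h (suc (K ℕ.+ suc j)) ≡ h′ (suc (K ∸ suc j))
  mirror j j<K = trans (cong h index) (h≡h′ (suc d) (s≤s (ℕP.≤-trans d≤K+K (ℕP.n≤1+n _))))
    where
    d = K ∸ suc j
    d≤K+K : d ≤ K ℕ.+ K
    d≤K+K = ℕP.≤-trans (ℕP.m∸n≤m K (suc j)) (ℕP.m≤n+m K K)
    index : suc (K ℕ.+ suc j) ≡ suc (K ℕ.+ K) ∸ d
    index = begin
      suc (K ℕ.+ suc j)        ≡⟨ cong suc (ℕP.+-suc K j) ⟩
      suc (suc (K ℕ.+ j))      ≡⟨ cong suc ([K+K]∸[K∸[1+j]]≡1+K+j K j j<K) ⟨
      suc ((K ℕ.+ K) ∸ d)      ≡⟨ ℕP.+-∸-assoc 1 d≤K+K ⟨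
      suc (K ℕ.+ K) ∸ d        ∎

Σω-unique : ∀ (f : ℕ → ℚω) {σ : ℕ → ℚω} → σ 0 ≡ 0# → (∀ K → σ (suc K) ≡ σ K + f (suc K)) → ∀ K → σ K ≡ Σω K (λ r → f (suc r))
Σω-unique f     σ₀ σ-suc zero    = σ₀
Σω-unique f {σ} σ₀ σ-suc (suc K) = trans (σ-suc K) (cong (_+ f (suc K)) (Σω-unique f {σ} σ₀ σ-suc K))

embed-Σ< : ∀ m (f : ℕ → ℚ) → embed (Σ< m f) ≡ Σω m (λ r → embed (f r))
embed-Σ< zero    f = refl
embed-Σ< (suc m) f = cong (_+ embed (f m)) (embed-Σ< m f)

-- Binomial coefficients

nCk*k![n∸k]!≡n! : ∀ {n k} → k ≤ n → (n C k) ℕ.* (k ! ℕ.* (n ∸ k) !) ≡ n !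
nCk*k![n∸k]!≡n! {n} {k} k≤n =
  trans (cong (ℕ._* (k ! ℕ.* (n ∸ k) !)) (nCk≡n!/k![n-k]! k≤n))
        (m/n*n≡m {{ℕP._!*_!≢0 k (n ∸ k)}} (k![n∸k]!∣n! k≤n))

nC[l+j]*[l+j]Cl≡nCl*[n∸l]Cj : ∀ n l j → (n C (l ℕ.+ j)) ℕ.* ((l ℕ.+ j) C l) ≡ (n C l) ℕ.* ((n ∸ l) C j)
nC[l+j]*[l+j]Cl≡nCl*[n∸l]Cj n l j with l ℕ.+ j ℕ.≤? n
... | no l+j≰n = trans (cong (ℕ._* ((l ℕ.+ j) C l)) (k>n⇒nCk≡0 (ℕP.≰⇒> l+j≰n))) (sym rhs≡0)
  where
  rhs≡0 : (n C l) ℕ.* ((n ∸ l) C j) ≡ 0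
  rhs≡0 with l ℕ.≤? n
  ... | no l≰n = cong (ℕ._* ((n ∸ l) C j)) (k>n⇒nCk≡0 (ℕP.≰⇒> l≰n))
  ... | yes l≤n = trans (cong ((n C l) ℕ.*_) (k>n⇒nCk≡0 n∸l<j)) (ℕP.*-zeroʳ (n C l))
    where
    n∸l<j : n ∸ l < j
    n∸l<j = ℕP.+-cancelˡ-< l (n ∸ l) j (subst (ℕ._< l ℕ.+ j) (sym (ℕP.m+[n∸m]≡n l≤n)) (ℕP.≰⇒> l+j≰n))
... | yes l+j≤n = ℕP.*-cancelʳ-≡ _ _ (l ! ℕ.* (j ! ℕ.* c !)) {{nonZero}} (trans lhs≡n! (sym rhs≡n!))
  where
  module ℕS = ℕ-Solver.+-*-Solver
  c = n ∸ (l ℕ.+ j)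
  l≤n = ℕP.≤-trans (ℕP.m≤m+n l j) l+j≤n
  nonZero : ℕ.NonZero (l ! ℕ.* (j ! ℕ.* c !))
  nonZero = ℕP.m*n≢0 _ _ {{ℕP._!≢0 l}} {{ℕP.m*n≢0 _ _ {{ℕP._!≢0 j}} {{ℕP._!≢0 c}}}}
  lhs≡n! : (n C (l ℕ.+ j)) ℕ.* ((l ℕ.+ j) C l) ℕ.* (l ! ℕ.* (j ! ℕ.* c !)) ≡ n !
  lhs≡n! = trans (ℕS.solve 5 (λ a b x y z → a ℕS.:* b ℕS.:* (x ℕS.:* (y ℕS.:* z)) ℕS.:= a ℕS.:* ((b ℕS.:* (x ℕS.:* y)) ℕS.:* z)) refl
                         (n C (l ℕ.+ j)) ((l ℕ.+ j) C l) (l !) (j !) (c !))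
          (trans (cong (λ w → (n C (l ℕ.+ j)) ℕ.* (w ℕ.* c !))
                       (trans (cong (λ z → ((l ℕ.+ j) C l) ℕ.* (l ! ℕ.* z !)) (sym (ℕP.m+n∸m≡n l j)))
                              (nCk*k![n∸k]!≡n! (ℕP.m≤m+n l j))))
                 (nCk*k![n∸k]!≡n! l+j≤n))
  rhs≡n! : (n C l) ℕ.* ((n ∸ l) C j) ℕ.* (l ! ℕ.* (j ! ℕ.* c !)) ≡ n !
  rhs≡n! = trans (ℕS.solve 5 (λ a d x y z → a ℕS.:* d ℕS.:* (x ℕS.:* (y ℕS.:* z)) ℕS.:= a ℕS.:* (x ℕS.:* (d ℕS.:* (y ℕS.:* z)))) refl
                         (n C l) ((n ∸ l) C j) (l !) (j !) (c !))
          (trans (cong (λ w → (n C l) ℕ.* (l ! ℕ.* w))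
                       (trans (cong (λ z → ((n ∸ l) C j) ℕ.* (j ! ℕ.* z !)) (sym (ℕP.∸-+-assoc n l j)))
                              (nCk*k![n∸k]!≡n! (ℕP.+-cancelˡ-≤ l j (n ∸ l) (subst (l ℕ.+ j ≤_) (sym (ℕP.m+[n∸m]≡n l≤n)) l+j≤n)))))
                 (nCk*k![n∸k]!≡n! l≤n))

Cω : ℕ → ℕ → ℚω
Cω n k = ℕ→ℚω (n C k)

Cω-pascal : ∀ k l → Cω (suc k) (suc l) ≡ Cω k l + Cω k (suc l)
Cω-pascal k l = trans (cong ℕ→ℚω (sym (nCk+nC[k+1]≡[n+1]C[k+1] k l))) (ℕ→ℚω-+ (k C l) (k C suc l))

Cω-> : ∀ {k l} → k < l → Cω k l ≡ 0#
Cω-> k<l = cong ℕ→ℚω (k>n⇒nCk≡0 k<l)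

Cω-sym : ∀ {n k} → k ≤ n → Cω n (n ∸ k) ≡ Cω n k
Cω-sym k≤n = cong ℕ→ℚω (sym (nCk≡nC[n∸k] k≤n))

Cω[1+n]n≡1+n : ∀ n → Cω (suc n) n ≡ ℕ→ℚω (suc n)
Cω[1+n]n≡1+n n = begin
  Cω (suc n) n            ≡⟨ Cω-sym (ℕP.n≤1+n n) ⟨
  Cω (suc n) (suc n ∸ n)  ≡⟨ cong (Cω (suc n)) (ℕP.m+n∸n≡m 1 n) ⟩
  Cω (suc n) 1            ≡⟨ cong ℕ→ℚω (nC1≡n (suc n)) ⟩
  ℕ→ℚω (suc n)            ∎
  where open ≡-Reasoning

binomial-theorem : ∀ x k N → k < N → (x + 1#) ^ω k ≡ Σω N (λ l → Cω k l * x ^ω l)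
binomial-theorem x zero N 0<N =
  sym (trans (Σω-single N 0 0<N higher≡0) (*-identityˡ 1#))
  where
  higher≡0 : ∀ l → l < N → l ≢ 0 → Cω 0 l * x ^ω l ≡ 0#
  higher≡0 zero    _ l≢0 = ⊥-elim (l≢0 refl)
  higher≡0 (suc l) _ _   = solve 1 (λ y → con 0# :* y := con 0#) refl (x ^ω suc l)
binomial-theorem x (suc k) (suc N) (s≤s k<N) = begin
  (x + 1#) * (x + 1#) ^ω k                        ≡⟨ cong ((x + 1#) *_) (binomial-theorem x k (suc N) (ℕP.m<n⇒m<1+n k<N)) ⟩
  (x + 1#) * Σω (suc N) T                         ≡⟨ cong ((x + 1#) *_) (Σω-sucˡ N T) ⟩
  (x + 1#) * (1# + Σω N T′)                       ≡⟨ solve 2 (λ x s → (x :+ con 1#) :* (con 1# :+ s) := con 1# :+ (x :* (con 1# :+ s) :+ s)) refl x (Σω N T′) ⟩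
  1# + (x * (1# + Σω N T′) + Σω N T′)             ≡⟨ cong (λ z → 1# + (x * z + Σω N T′)) (trans (sym (Σω-sucˡ N T)) top≡0) ⟩
  1# + (x * Σω N T + Σω N T′)                     ≡⟨ cong (λ z → 1# + (z + Σω N T′)) (Σω-*ˡ N x T) ⟨
  1# + (Σω N (λ l → x * T l) + Σω N T′)           ≡⟨ cong (1# +_) (Σω-+ N (λ l → x * T l) T′) ⟨
  1# + Σω N (λ l → x * T l + T′ l)                ≡⟨ cong (1# +_) (Σω-cong N (λ l _ → pascal l)) ⟩
  1# + Σω N (λ l → Cω (suc k) (suc l) * x ^ω suc l) ≡⟨ Σω-sucˡ N (λ l → Cω (suc k) l * x ^ω l) ⟨
  Σω (suc N) (λ l → Cω (suc k) l * x ^ω l)        ∎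
  where
  open ≡-Reasoning
  T T′ : ℕ → ℚω
  T l = Cω k l * x ^ω l
  T′ l = T (suc l)
  top≡0 : Σω (suc N) T ≡ Σω N T
  top≡0 = trans (cong (Σω N T +_) (trans (cong (_* x ^ω N) (Cω-> k<N)) (solve 1 (λ y → con 0# :* y := con 0#) refl (x ^ω N))))
                (+-identityʳ (Σω N T))
  pascal : ∀ l → x * T l + T′ l ≡ Cω (suc k) (suc l) * x ^ω suc l
  pascal l = trans (solve 4 (λ x a b p → x :* (a :* p) :+ b :* (x :* p) := (a :+ b) :* (x :* p)) refl x (Cω k l) (Cω k (suc l)) (x ^ω l))
                   (cong (_* x ^ω suc l) (sym (Cω-pascal k l)))

-- Bernoulli numbers

lookupℕ : ∀ {j} → Vec ℚ j → ℕ → ℚ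
lookupℕ []       k       = 0ℚ
lookupℕ (x ∷ xs) zero    = x
lookupℕ (x ∷ xs) (suc k) = lookupℕ xs k

lookupℕ-∷ʳ-< : ∀ {n} (xs : Vec ℚ n) y {k} → k < n → lookupℕ (xs ∷ʳ y) k ≡ lookupℕ xs k
lookupℕ-∷ʳ-< (x ∷ xs) y {zero}  _         = refl
lookupℕ-∷ʳ-< (x ∷ xs) y {suc k} (s≤s k<n) = lookupℕ-∷ʳ-< xs y k<n

lookupℕ-∷ʳ-last : ∀ {n} (xs : Vec ℚ n) y → lookupℕ (xs ∷ʳ y) n ≡ y
lookupℕ-∷ʳ-last []       y = refl
lookupℕ-∷ʳ-last (x ∷ xs) y = lookupℕ-∷ʳ-last xs y

lookup-fromℕ : ∀ n (xs : Vec ℚ (suc n)) → lookup xs (fromℕ n) ≡ lookupℕ xs n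
lookup-fromℕ zero    (x ∷ xs) = refl
lookup-fromℕ (suc n) (x ∷ xs) = lookup-fromℕ n xs

lookupℕ-bernVec : ∀ n k → k ≤ n → lookupℕ (bernVec n) k ≡ bernoulli k
lookupℕ-bernVec zero    zero z≤n = refl
lookupℕ-bernVec (suc m) k    k≤m+1 =
  [ (λ k<m+1 → trans (lookupℕ-∷ʳ-< (bernVec m) _ k<m+1) (lookupℕ-bernVec m k (ℕP.≤-pred k<m+1)))
  , (λ k≡m+1 → subst (λ k → lookupℕ (bernVec (suc m)) k ≡ bernoulli k) (sym k≡m+1) (sym (lookup-fromℕ (suc m) (bernVec (suc m)))))
  ]′ (ℕP.m≤n⇒m<n∨m≡n k≤m+1)

embed-foldr-zipWith : ∀ (g : ℕ → ℚ → ℚ) j (h : ℕ → ℕ) (v : Vec ℚ j) →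
  embed (Vec.foldr _ ℚ._+_ 0ℚ (Vec.zipWith g (tabulate (h ∘ toℕ)) v)) ≡ Σω j (λ k → embed (g (h k) (lookupℕ v k)))
embed-foldr-zipWith g zero    h []      = refl
embed-foldr-zipWith g (suc j) h (x ∷ v) =
  trans (cong (embed (g (h 0) x) +_) (embed-foldr-zipWith g j (h ∘ suc) v))
        (sym (Σω-sucˡ j (λ k → embed (g (h k) (lookupℕ (x ∷ v) k)))))

Bω : ℕ → ℚω
Bω k = embed (bernoulli k)

bernoulli-suc : ∀ m → Bω (suc m) ≡ - (embed (ℤ.+ 1 / suc (suc m)) * Σω (suc m) (λ k → Cω (suc (suc m)) k * Bω k))
bernoulli-suc m = begin
  Bω (suc m)                                        ≡⟨ cong embed (lookup-fromℕ (suc m) (bernVec (suc m))) ⟩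
  embed (lookupℕ (bernVec m ∷ʳ next) (suc m))       ≡⟨ cong embed (lookupℕ-∷ʳ-last (bernVec m) next) ⟩
  - embed ((ℤ.+ 1 / suc (suc m)) ℚ.* sum)             ≡⟨ cong -_ (embed-* (ℤ.+ 1 / suc (suc m)) sum) ⟩
  - (embed (ℤ.+ 1 / suc (suc m)) * embed sum)         ≡⟨ cong (λ z → - (embed (ℤ.+ 1 / suc (suc m)) * z)) embed-sum ⟩
  - (embed (ℤ.+ 1 / suc (suc m)) * Σω (suc m) (λ k → Cω (suc (suc m)) k * Bω k)) ∎
  where
  open ≡-Reasoning
  g : ℕ → ℚ → ℚ
  g k x = ℕ→ℚ (suc (suc m) C k) ℚ.* x
  sum = Vec.foldr _ ℚ._+_ 0ℚ (Vec.zipWith g (Vec.map toℕ (Vec.allFin (suc m))) (bernVec m))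
  next = ℚ.- ((ℤ.+ 1 / suc (suc m)) ℚ.* sum)
  embed-sum : embed sum ≡ Σω (suc m) (λ k → Cω (suc (suc m)) k * Bω k)
  embed-sum = begin
    embed sum                                                   ≡⟨ cong (λ z → embed (Vec.foldr _ ℚ._+_ 0ℚ (Vec.zipWith g z (bernVec m)))) (sym (VecP.tabulate-∘ toℕ (λ i → i))) ⟩
    embed (Vec.foldr _ ℚ._+_ 0ℚ (Vec.zipWith g (tabulate toℕ) (bernVec m)))
                                                                ≡⟨ embed-foldr-zipWith g (suc m) (λ k → k) (bernVec m) ⟩
    Σω (suc m) (λ k → embed (g k (lookupℕ (bernVec m) k)))      ≡⟨ Σω-cong (suc m) (λ k k< → trans (embed-* (ℕ→ℚ (suc (suc m) C k)) _)
                                                                     (cong (λ z → Cω (suc (suc m)) k * embed z) (lookupℕ-bernVec m k (ℕP.≤-pred k<)))) ⟩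
    Σω (suc m) (λ k → Cω (suc (suc m)) k * Bω k)                ∎

bernoulli-Σ≡0 : ∀ m → Σω (suc (suc m)) (λ i → Cω (suc (suc m)) i * Bω i) ≡ 0#
bernoulli-Σ≡0 m = begin
  Σ + Cω (suc (suc m)) (suc m) * Bω (suc m)   ≡⟨ cong₂ (λ u v → Σ + u * v) (Cω[1+n]n≡1+n (suc m)) (bernoulli-suc m) ⟩
  Σ + c * (- (i * Σ))                         ≡⟨ solve 3 (λ s c i → s :+ c :* (:- (i :* s)) := s :- (c :* i) :* s) refl Σ c i ⟩
  Σ - c * i * Σ                               ≡⟨ cong (λ z → Σ - z * Σ) (ℕ→ℚω-inverse (suc m)) ⟩
  Σ - 1# * Σ                                  ≡⟨ solve 1 (λ s → s :- con 1# :* s := con 0#) refl Σ ⟩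
  0#                                          ∎
  where
  open ≡-Reasoning
  Σ = Σω (suc m) (λ k → Cω (suc (suc m)) k * Bω k)
  c = ℕ→ℚω (suc (suc m))
  i = embed (ℤ.+ 1 / suc (suc m))

δ₁ : ℕ → ℚω
δ₁ 1 = 1#
δ₁ _ = 0#

Σω-Cω-Bω : ∀ M → Σω (suc M) (λ i → Cω M i * Bω i) ≡ Bω M + δ₁ M
Σω-Cω-Bω zero          = solve 1 (λ y → con 0# :+ con 1# :* y := y :+ con 0#) refl (Bω 0)
Σω-Cω-Bω (suc zero)    = solve 1 (λ y → con 0# :+ con 1# :* con 1# :+ con 1# :* y := y :+ con 1#) refl (Bω 1)
Σω-Cω-Bω (suc (suc m)) = begin
  Σω (suc (suc m)) (λ i → Cω (suc (suc m)) i * Bω i) + Cω (suc (suc m)) (suc (suc m)) * Bω (suc (suc m))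
    ≡⟨ cong₂ (λ u v → u + ℕ→ℚω v * Bω (suc (suc m))) (bernoulli-Σ≡0 m) (nCn≡1 (suc (suc m))) ⟩
  0# + 1# * Bω (suc (suc m))
    ≡⟨ solve 1 (λ y → con 0# :+ con 1# :* y := y :+ con 0#) refl (Bω (suc (suc m))) ⟩
  Bω (suc (suc m)) + 0# ∎
  where open ≡-Reasoning

-- Bernoulli polynomials

bernoulliPoly : ℕ → ℚω → ℚω
bernoulliPoly n x = Σω (suc n) (λ k → Cω n k * Bω (n ∸ k) * x ^ω k)

bernoulliPoly-0 : ∀ n → bernoulliPoly n 0# ≡ Bω n
bernoulliPoly-0 n = begin
  bernoulliPoly n 0#                                            ≡⟨ Σω-sucˡ n _ ⟩
  1# * Bω n * 1# + Σω n (λ k → Cω n (suc k) * Bω (n ∸ suc k) * 0# ^ω suc k)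
    ≡⟨ cong₂ _+_ (solve 1 (λ y → con 1# :* y :* con 1# := y) refl (Bω n)) (Σω-zero n (λ k _ → vanish k)) ⟩
  Bω n + 0#                                                     ≡⟨ +-identityʳ (Bω n) ⟩
  Bω n                                                          ∎
  where
  open ≡-Reasoning
  vanish : ∀ k → Cω n (suc k) * Bω (n ∸ suc k) * 0# ^ω suc k ≡ 0#
  vanish k = trans (cong (Cω n (suc k) * Bω (n ∸ suc k) *_) (^ω-zeroˡ k))
                   (solve 2 (λ a c → a :* c :* con 0# := con 0#) refl (Cω n (suc k)) (Bω (n ∸ suc k)))

Σω-Cω-reflect : ∀ M (h : ℕ → ℕ → ℚω) → Σω (suc M) (λ k → Cω M k * h (M ∸ k) k) ≡ Σω (suc M) (λ i → Cω M i * h i (M ∸ i))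
Σω-Cω-reflect M h = trans (Σω-reverse M (λ k → Cω M k * h (M ∸ k) k)) (Σω-cong (suc M) reflect)
  where
  reflect : ∀ k → k < suc M → Cω M (M ∸ k) * h (M ∸ (M ∸ k)) (M ∸ k) ≡ Cω M k * h k (M ∸ k)
  reflect k k< = cong₂ (λ u v → u * h v (M ∸ k)) (Cω-sym (ℕP.≤-pred k<)) (ℕP.m∸[m∸n]≡n (ℕP.≤-pred k<))

Σω-Cω-Cω-Bω : ∀ n l → l ≤ n → Σω (suc n) (λ k → Cω n k * Cω k l * Bω (n ∸ k)) ≡ Cω n l * (Bω (n ∸ l) + δ₁ (n ∸ l))
Σω-Cω-Cω-Bω n l l≤n = begin
  Σω (suc n) U                                              ≡⟨ cong (λ z → Σω z U) (sym n+1≡l+[M+1]) ⟩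
  Σω (l ℕ.+ suc M) U                                        ≡⟨ Σω-split l (suc M) U ⟩
  Σω l U + Σω (suc M) (λ j → U (l ℕ.+ j))                   ≡⟨ cong₂ _+_ (Σω-zero l U<l≡0) (Σω-cong (suc M) (λ j _ → U[l+j] j)) ⟩
  0# + Σω (suc M) (λ j → Cω n l * (Cω M j * Bω (M ∸ j)))    ≡⟨ +-identityˡ _ ⟩
  Σω (suc M) (λ j → Cω n l * (Cω M j * Bω (M ∸ j)))         ≡⟨ Σω-*ˡ (suc M) (Cω n l) (λ j → Cω M j * Bω (M ∸ j)) ⟩
  Cω n l * Σω (suc M) (λ j → Cω M j * Bω (M ∸ j))           ≡⟨ cong (Cω n l *_) (Σω-Cω-reflect M (λ a _ → Bω a)) ⟩
  Cω n l * Σω (suc M) (λ j → Cω M j * Bω j)                 ≡⟨ cong (Cω n l *_) (Σω-Cω-Bω M) ⟩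
  Cω n l * (Bω M + δ₁ M)                                    ∎
  where
  open ≡-Reasoning
  M = n ∸ l
  U : ℕ → ℚω
  U k = Cω n k * Cω k l * Bω (n ∸ k)
  n+1≡l+[M+1] : l ℕ.+ suc M ≡ suc n
  n+1≡l+[M+1] = trans (ℕP.+-suc l M) (cong suc (ℕP.m+[n∸m]≡n l≤n))
  U<l≡0 : ∀ k → k < l → U k ≡ 0#
  U<l≡0 k k<l = trans (cong (λ z → Cω n k * z * Bω (n ∸ k)) (Cω-> k<l))
                      (solve 2 (λ a c → a :* con 0# :* c := con 0#) refl (Cω n k) (Bω (n ∸ k)))
  U[l+j] : ∀ j → U (l ℕ.+ j) ≡ Cω n l * (Cω M j * Bω (M ∸ j))
  U[l+j] j = begin
    Cω n (l ℕ.+ j) * Cω (l ℕ.+ j) l * Bω (n ∸ (l ℕ.+ j))           ≡⟨ cong (_* Bω (n ∸ (l ℕ.+ j))) (ℕ→ℚω-* (n C (l ℕ.+ j)) ((l ℕ.+ j) C l)) ⟨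
    ℕ→ℚω ((n C (l ℕ.+ j)) ℕ.* ((l ℕ.+ j) C l)) * Bω (n ∸ (l ℕ.+ j))  ≡⟨ cong₂ (λ u v → ℕ→ℚω u * Bω v) (nC[l+j]*[l+j]Cl≡nCl*[n∸l]Cj n l j) (sym (ℕP.∸-+-assoc n l j)) ⟩
    ℕ→ℚω ((n C l) ℕ.* (M C j)) * Bω (M ∸ j)                          ≡⟨ cong (_* Bω (M ∸ j)) (ℕ→ℚω-* (n C l) (M C j)) ⟩
    Cω n l * Cω M j * Bω (M ∸ j)                                   ≡⟨ *-assoc (Cω n l) (Cω M j) (Bω (M ∸ j)) ⟩
    Cω n l * (Cω M j * Bω (M ∸ j))                                 ∎

δ₁[1+n∸l]≡0 : ∀ n l → l ≢ n → δ₁ (suc n ∸ l) ≡ 0#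
δ₁[1+n∸l]≡0 zero    zero          l≢n = ⊥-elim (l≢n refl)
δ₁[1+n∸l]≡0 (suc n) zero          l≢n = refl
δ₁[1+n∸l]≡0 zero    (suc zero)    l≢n = refl
δ₁[1+n∸l]≡0 zero    (suc (suc l)) l≢n = refl
δ₁[1+n∸l]≡0 (suc n) (suc l)       l≢n = δ₁[1+n∸l]≡0 n l (l≢n ∘ cong suc)

Σω-Cω-δ₁ : ∀ n x → Σω (suc n) (λ l → Cω n l * δ₁ (n ∸ l) * x ^ω l) ≡ ℕ→ℚω n * x ^ω (n ∸ 1)
Σω-Cω-δ₁ zero    x = solve 1 (λ y → con 0# :+ con 1# :* con 0# :* con 1# := con 0# :* con 1#) refl x
Σω-Cω-δ₁ (suc n) x = begin
  Σω (suc (suc n)) (λ l → Cω (suc n) l * δ₁ (suc n ∸ l) * x ^ω l)  ≡⟨ Σω-single (suc (suc n)) n (ℕP.m<n⇒m<1+n (ℕP.n<1+n n)) others≡0 ⟩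
  Cω (suc n) n * δ₁ (suc n ∸ n) * x ^ω n                         ≡⟨ cong₂ (λ c z → c * δ₁ z * x ^ω n) (Cω[1+n]n≡1+n n) (ℕP.m+n∸n≡m 1 n) ⟩
  ℕ→ℚω (suc n) * 1# * x ^ω n                                      ≡⟨ cong (_* x ^ω n) (*-identityʳ (ℕ→ℚω (suc n))) ⟩
  ℕ→ℚω (suc n) * x ^ω n                                           ∎
  where
  open ≡-Reasoning
  others≡0 : ∀ l → l < suc (suc n) → l ≢ n → Cω (suc n) l * δ₁ (suc n ∸ l) * x ^ω l ≡ 0#
  others≡0 l _ l≢n = trans (cong (λ z → Cω (suc n) l * z * x ^ω l) (δ₁[1+n∸l]≡0 n l l≢n))
                           (solve 2 (λ a c → a :* con 0# :* c := con 0#) refl (Cω (suc n) l) (x ^ω l))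

bernoulliPoly-+1 : ∀ n x → bernoulliPoly n (x + 1#) ≡ bernoulliPoly n x + ℕ→ℚω n * x ^ω (n ∸ 1)
bernoulliPoly-+1 n x = begin
  bernoulliPoly n (x + 1#)                              ≡⟨ Σω-cong (suc n) expand ⟩
  Σω (suc n) (λ k → Σω (suc n) (T k))                   ≡⟨ Σω-swap (suc n) (suc n) T ⟩
  Σω (suc n) (λ l → Σω (suc n) (λ k → T k l))           ≡⟨ Σω-cong (suc n) collect ⟩
  Σω (suc n) (λ l → Cω n l * Bω (n ∸ l) * x ^ω l + Cω n l * δ₁ (n ∸ l) * x ^ω l)
                                                        ≡⟨ Σω-+ (suc n) _ _ ⟩
  bernoulliPoly n x + Σω (suc n) (λ l → Cω n l * δ₁ (n ∸ l) * x ^ω l)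
                                                        ≡⟨ cong (bernoulliPoly n x +_) (Σω-Cω-δ₁ n x) ⟩
  bernoulliPoly n x + ℕ→ℚω n * x ^ω (n ∸ 1)             ∎
  where
  open ≡-Reasoning
  A : ℕ → ℚω
  A k = Cω n k * Bω (n ∸ k)
  T : ℕ → ℕ → ℚω
  T k l = A k * (Cω k l * x ^ω l)
  expand : ∀ k → k < suc n → A k * (x + 1#) ^ω k ≡ Σω (suc n) (T k)
  expand k k< = trans (cong (A k *_) (binomial-theorem x k (suc n) k<)) (sym (Σω-*ˡ (suc n) (A k) (λ l → Cω k l * x ^ω l)))
  collect : ∀ l → l < suc n → Σω (suc n) (λ k → T k l) ≡ Cω n l * Bω (n ∸ l) * x ^ω l + Cω n l * δ₁ (n ∸ l) * x ^ω l
  collect l l< = begin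
    Σω (suc n) (λ k → T k l)                                ≡⟨ Σω-cong (suc n) (λ k _ → solve 4 (λ a d c p → (a :* d) :* (c :* p) := p :* (a :* c :* d)) refl
                                                                                        (Cω n k) (Bω (n ∸ k)) (Cω k l) (x ^ω l)) ⟩
    Σω (suc n) (λ k → x ^ω l * (Cω n k * Cω k l * Bω (n ∸ k)))  ≡⟨ Σω-*ˡ (suc n) (x ^ω l) _ ⟩
    x ^ω l * Σω (suc n) (λ k → Cω n k * Cω k l * Bω (n ∸ k))    ≡⟨ cong (x ^ω l *_) (Σω-Cω-Cω-Bω n l (ℕP.≤-pred l<)) ⟩
    x ^ω l * (Cω n l * (Bω (n ∸ l) + δ₁ (n ∸ l)))             ≡⟨ solve 4 (λ p c d i → p :* (c :* (d :+ i)) := c :* d :* p :+ c :* i :* p) refl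
                                                                    (x ^ω l) (Cω n l) (Bω (n ∸ l)) (δ₁ (n ∸ l)) ⟩
    Cω n l * Bω (n ∸ l) * x ^ω l + Cω n l * δ₁ (n ∸ l) * x ^ω l ∎

bernoulliPoly-+ℕ : ∀ n x m → bernoulliPoly n (x + ℕ→ℚω m) ≡ bernoulliPoly n x + ℕ→ℚω n * Σω m (λ r → (x + ℕ→ℚω r) ^ω (n ∸ 1))
bernoulliPoly-+ℕ n x zero = trans (cong (bernoulliPoly n) (+-identityʳ x))
                                  (solve 2 (λ p c → p := p :+ c :* con 0#) refl (bernoulliPoly n x) (ℕ→ℚω n))
bernoulliPoly-+ℕ n x (suc m) = begin
  bernoulliPoly n (x + ℕ→ℚω (suc m))                    ≡⟨ cong (λ z → bernoulliPoly n (x + z)) (ℕ→ℚω-+ 1 m) ⟩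
  bernoulliPoly n (x + (1# + ℕ→ℚω m))                   ≡⟨ cong (bernoulliPoly n) (solve 2 (λ x r → x :+ (con 1# :+ r) := (x :+ r) :+ con 1#) refl x (ℕ→ℚω m)) ⟩
  bernoulliPoly n (x + ℕ→ℚω m + 1#)                     ≡⟨ bernoulliPoly-+1 n (x + ℕ→ℚω m) ⟩
  bernoulliPoly n (x + ℕ→ℚω m) + ℕ→ℚω n * y ^ω (n ∸ 1)  ≡⟨ cong (_+ ℕ→ℚω n * y ^ω (n ∸ 1)) (bernoulliPoly-+ℕ n x m) ⟩
  bernoulliPoly n x + ℕ→ℚω n * Σ + ℕ→ℚω n * y ^ω (n ∸ 1)
    ≡⟨ solve 4 (λ p c s t → p :+ c :* s :+ c :* t := p :+ c :* (s :+ t)) refl (bernoulliPoly n x) (ℕ→ℚω n) Σ (y ^ω (n ∸ 1)) ⟩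
  bernoulliPoly n x + ℕ→ℚω n * (Σ + y ^ω (n ∸ 1))       ∎
  where
  open ≡-Reasoning
  y = x + ℕ→ℚω m
  Σ = Σω m (λ r → (x + ℕ→ℚω r) ^ω (n ∸ 1))

alternating-Σω-Cω-Bω : ∀ N′ → let N = suc N′ in Σω N (λ i → Cω N i * ((- 1#) ^ω i * Bω i)) ≡ ℕ→ℚω N
alternating-Σω-Cω-Bω N′ = begin
  Σ                                              ≡⟨ solve 3 (λ a b p → a := (a :+ b :* p) :- b :* p) refl Σ (Bω N) s^N ⟩
  Σ + Bω N * s^N - Bω N * s^N                    ≡⟨ cong (_- Bω N * s^N) reflected ⟩
  s^N * bernoulliPoly N s - Bω N * s^N           ≡⟨ cong (λ z → s^N * z - Bω N * s^N) at-1 ⟩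
  s^N * (Bω N - ℕ→ℚω N * s ^ω N′) - Bω N * s^N  ≡⟨ solve 4 (λ y n t s → (s :* t) :* (y :- n :* t) :- y :* (s :* t) := n :* :- (s :* (t :* t)))
                                                           refl (Bω N) (ℕ→ℚω N) (s ^ω N′) s ⟩
  ℕ→ℚω N * - (s * (s ^ω N′ * s ^ω N′))          ≡⟨ cong (λ z → ℕ→ℚω N * - (s * z)) ([-1]^k*[-1]^k≡1 N′) ⟩
  ℕ→ℚω N * - (s * 1#)                            ≡⟨ solve 1 (λ n → n :* :- (:- con 1# :* con 1#) := n) refl (ℕ→ℚω N) ⟩
  ℕ→ℚω N                                         ∎
  where
  open ≡-Reasoning
  N = suc N′
  s = - 1#
  s^N = s ^ω N
  Σ = Σω N (λ i → Cω N i * (s ^ω i * Bω i))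
  at-1 : bernoulliPoly N s ≡ Bω N - ℕ→ℚω N * s ^ω N′
  at-1 = begin
    bernoulliPoly N s                                         ≡⟨ solve 2 (λ p q → p := (p :+ q) :- q) refl (bernoulliPoly N s) (ℕ→ℚω N * s ^ω N′) ⟩
    bernoulliPoly N s + ℕ→ℚω N * s ^ω N′ - ℕ→ℚω N * s ^ω N′   ≡⟨ cong (_- ℕ→ℚω N * s ^ω N′) (bernoulliPoly-+1 N s) ⟨
    bernoulliPoly N (s + 1#) - ℕ→ℚω N * s ^ω N′              ≡⟨ cong (λ z → bernoulliPoly N z - ℕ→ℚω N * s ^ω N′) (solve 0 (:- con 1# :+ con 1# := con 0#) refl) ⟩
    bernoulliPoly N 0# - ℕ→ℚω N * s ^ω N′                    ≡⟨ cong (_- ℕ→ℚω N * s ^ω N′) (bernoulliPoly-0 N) ⟩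
    Bω N - ℕ→ℚω N * s ^ω N′                                  ∎
  s^N*s^[N∸i]≡s^i : ∀ i → i ≤ N → s^N * s ^ω (N ∸ i) ≡ s ^ω i
  s^N*s^[N∸i]≡s^i i i≤N = begin
    s^N * s ^ω (N ∸ i)                            ≡⟨ cong (λ z → s ^ω z * s ^ω (N ∸ i)) (ℕP.m+[n∸m]≡n i≤N) ⟨
    s ^ω (i ℕ.+ (N ∸ i)) * s ^ω (N ∸ i)           ≡⟨ cong (_* s ^ω (N ∸ i)) (^ω-distribˡ-+-* s i (N ∸ i)) ⟩
    s ^ω i * s ^ω (N ∸ i) * s ^ω (N ∸ i)          ≡⟨ *-assoc (s ^ω i) _ _ ⟩
    s ^ω i * (s ^ω (N ∸ i) * s ^ω (N ∸ i))        ≡⟨ cong (s ^ω i *_) ([-1]^k*[-1]^k≡1 (N ∸ i)) ⟩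
    s ^ω i * 1#                                   ≡⟨ *-identityʳ _ ⟩
    s ^ω i                                        ∎
  reflected : Σ + Bω N * s^N ≡ s^N * bernoulliPoly N s
  reflected = sym (begin
    s^N * bernoulliPoly N s                                     ≡⟨ cong (s^N *_) (Σω-cong (suc N) (λ k _ → *-assoc (Cω N k) (Bω (N ∸ k)) (s ^ω k))) ⟩
    s^N * Σω (suc N) (λ k → Cω N k * (Bω (N ∸ k) * s ^ω k))     ≡⟨ cong (s^N *_) (Σω-Cω-reflect N (λ a k → Bω a * s ^ω k)) ⟩
    s^N * Σω (suc N) (λ i → Cω N i * (Bω i * s ^ω (N ∸ i)))     ≡⟨ Σω-*ˡ (suc N) s^N _ ⟨
    Σω (suc N) (λ i → s^N * (Cω N i * (Bω i * s ^ω (N ∸ i))))   ≡⟨ Σω-cong (suc N) (λ i i< → trans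
                                                                     (solve 4 (λ t c y u → t :* (c :* (y :* u)) := c :* ((t :* u) :* y)) refl s^N (Cω N i) (Bω i) (s ^ω (N ∸ i)))
                                                                     (cong (λ z → Cω N i * (z * Bω i)) (s^N*s^[N∸i]≡s^i i (ℕP.≤-pred i<)))) ⟩
    Σ + Cω N N * (s^N * Bω N)                                   ≡⟨ cong (λ z → Σ + ℕ→ℚω z * (s^N * Bω N)) (nCn≡1 N) ⟩
    Σ + 1# * (s^N * Bω N)                                       ≡⟨ cong (Σ +_) (solve 2 (λ t y → con 1# :* (t :* y) := y :* t) refl s^N (Bω N)) ⟩
    Σ + Bω N * s^N                                              ∎)

last-of-Σω-Cω≡0 : ∀ k (x : ℕ → ℚω) → let N = suc (suc k) in
  Σω N (λ i → Cω N i * x i) ≡ 0# → ℕ→ℚω N * x (suc k) ≡ - Σω (suc k) (λ i → Cω N i * x i)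
last-of-Σω-Cω≡0 k x Σ≡0 = begin
  ℕ→ℚω N * x (suc k)                  ≡⟨ solve 2 (λ a u → u := (a :+ u) :- a) refl Σ′ (ℕ→ℚω N * x (suc k)) ⟩
  Σ′ + ℕ→ℚω N * x (suc k) - Σ′        ≡⟨ cong (λ c → Σ′ + c * x (suc k) - Σ′) (Cω[1+n]n≡1+n (suc k)) ⟨
  Σω N (λ i → Cω N i * x i) - Σ′      ≡⟨ cong (_- Σ′) Σ≡0 ⟩
  0# - Σ′                             ≡⟨ +-identityˡ (- Σ′) ⟩
  - Σ′                                ∎
  where
  open ≡-Reasoning
  N = suc (suc k)
  Σ′ = Σω (suc k) (λ i → Cω N i * x i)

bernoulli-unique : ∀ (x : ℕ → ℚω) → x 0 ≡ 1# → (∀ m → Σω (suc (suc m)) (λ i → Cω (suc (suc m)) i * x i) ≡ 0#) → ∀ k → x k ≡ Bω k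
bernoulli-unique x x₀≡1 x-rec k = agree k k ℕP.≤-refl
  where
  agree : ∀ k i → i ≤ k → x i ≡ Bω i
  agree zero    zero z≤n    = x₀≡1
  agree (suc k) i    i≤k+1 = [ (λ i<k+1 → agree k i (ℕP.≤-pred i<k+1)) , (λ i≡k+1 → subst (λ i → x i ≡ Bω i) (sym i≡k+1) top) ]′
                               (ℕP.m≤n⇒m<n∨m≡n i≤k+1)
    where
    open ≡-Reasoning
    top : x (suc k) ≡ Bω (suc k)
    top = ℕ→ℚω-cancelˡ (suc k) (begin
      ℕ→ℚω (suc (suc k)) * x (suc k)                           ≡⟨ last-of-Σω-Cω≡0 k x (x-rec k) ⟩
      - Σω (suc k) (λ i → Cω (suc (suc k)) i * x i)            ≡⟨ cong -_ (Σω-cong (suc k) (λ i i<k+1 → cong (Cω (suc (suc k)) i *_) (agree k i (ℕP.≤-pred i<k+1)))) ⟩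
      - Σω (suc k) (λ i → Cω (suc (suc k)) i * Bω i)           ≡⟨ last-of-Σω-Cω≡0 k Bω (bernoulli-Σ≡0 k) ⟨
      ℕ→ℚω (suc (suc k)) * Bω (suc k)                          ∎)

bernoulli-odd : ∀ {j} → 1 ≤ j → Bω (suc (j ℕ.+ j)) ≡ 0#
bernoulli-odd {suc i} _ = ℕ→ℚω-cancelˡ 1 (begin
  ℕ→ℚω 2 * Bω N                   ≡⟨ solve 1 (λ y → con (ℕ→ℚω 2) :* y := y :+ y) refl (Bω N) ⟩
  Bω N + Bω N                     ≡⟨ cong (_+ Bω N) Bω-N≡-Bω-N ⟩
  - Bω N + Bω N                   ≡⟨ solve 1 (λ y → :- y :+ y := con (ℕ→ℚω 2) :* con 0#) refl (Bω N) ⟩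
  ℕ→ℚω 2 * 0#                     ∎)
  where
  open ≡-Reasoning
  N = suc (suc i ℕ.+ suc i)
  c : ℕ → ℚω
  c i = (- 1#) ^ω i * Bω i - δ₁ i
  c-rec : ∀ m → Σω (suc (suc m)) (λ i → Cω (suc (suc m)) i * c i) ≡ 0#
  c-rec m = begin
    Σω M (λ i → Cω M i * c i)                                         ≡⟨ Σω-cong M (λ i _ → solve 3 (λ c a d → c :* (a :- d) := c :* a :+ :- (c :* d)) refl (Cω M i) ((- 1#) ^ω i * Bω i) (δ₁ i)) ⟩
    Σω M (λ i → Cω M i * ((- 1#) ^ω i * Bω i) + - (Cω M i * δ₁ i))     ≡⟨ Σω-+ M _ _ ⟩
    Σω M (λ i → Cω M i * ((- 1#) ^ω i * Bω i)) + Σω M (λ i → - (Cω M i * δ₁ i))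
                                                                      ≡⟨ cong₂ _+_ (alternating-Σω-Cω-Bω (suc m)) (Σω-neg M (λ i → Cω M i * δ₁ i)) ⟩
    ℕ→ℚω M - Σω M (λ i → Cω M i * δ₁ i)                               ≡⟨ cong (λ z → ℕ→ℚω M - z) (Σω-single M 1 (s≤s (s≤s z≤n)) δ₁-elsewhere) ⟩
    ℕ→ℚω M - Cω M 1 * 1#                                              ≡⟨ cong (λ z → ℕ→ℚω M - ℕ→ℚω z * 1#) (nC1≡n M) ⟩
    ℕ→ℚω M - ℕ→ℚω M * 1#                                              ≡⟨ solve 1 (λ n → n :- n :* con 1# := con 0#) refl (ℕ→ℚω M) ⟩
    0#                                                                ∎
    where
    M = suc (suc m)
    δ₁-elsewhere : ∀ l → l < M → l ≢ 1 → Cω M l * δ₁ l ≡ 0#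
    δ₁-elsewhere zero          _ _   = solve 1 (λ c → c :* con 0# := con 0#) refl (Cω M 0)
    δ₁-elsewhere (suc zero)    _ l≢1 = ⊥-elim (l≢1 refl)
    δ₁-elsewhere (suc (suc l)) _ _   = solve 1 (λ c → c :* con 0# := con 0#) refl (Cω M (suc (suc l)))
  Bω-N≡-Bω-N : Bω N ≡ - Bω N
  Bω-N≡-Bω-N = begin
    Bω N                              ≡⟨ bernoulli-unique c refl c-rec N ⟨
    (- 1#) ^ω N * Bω N - δ₁ N         ≡⟨ cong₂ (λ z d → z * Bω N - d) ([-1]^[1+j+j]≡-1 (suc i)) δ₁[N]≡0 ⟩
    - 1# * Bω N - 0#                  ≡⟨ solve 1 (λ y → :- con 1# :* y :- con 0# := :- y) refl (Bω N) ⟩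
    - Bω N                            ∎
    where
    δ₁[N]≡0 : δ₁ N ≡ 0#
    δ₁[N]≡0 = refl

bernoulliPoly-neg : ∀ j x → let n = suc (j ℕ.+ j) in
  bernoulliPoly n (- x) ≡ - bernoulliPoly n x - ℕ→ℚω n * x ^ω (j ℕ.+ j)
bernoulliPoly-neg j x = begin
  bernoulliPoly n (- x)                        ≡⟨ solve 2 (λ p q → q := :- p :+ (p :+ q)) refl (bernoulliPoly n x) (bernoulliPoly n (- x)) ⟩
  - bernoulliPoly n x + (bernoulliPoly n x + bernoulliPoly n (- x))
                                               ≡⟨ cong (- bernoulliPoly n x +_) (sym (Σω-+ (suc n) _ _)) ⟩
  - bernoulliPoly n x + Σω (suc n) (λ k → Cω n k * Bω (n ∸ k) * x ^ω k + Cω n k * Bω (n ∸ k) * (- x) ^ω k)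
                                               ≡⟨ cong (- bernoulliPoly n x +_) (Σω-cong (suc n) (λ k _ → pair k)) ⟩
  - bernoulliPoly n x + Σω (suc n) W           ≡⟨ cong (- bernoulliPoly n x +_) (Σω-single (suc n) e (ℕP.m<n⇒m<1+n (ℕP.n<1+n e))
                                                                                            (λ k k<1+n k≢e → W≡0 k k<1+n k≢e (parity k))) ⟩
  - bernoulliPoly n x + W e                    ≡⟨ cong (- bernoulliPoly n x +_) W[e] ⟩
  - bernoulliPoly n x - ℕ→ℚω n * x ^ω e        ∎
  where
  open ≡-Reasoning
  e = j ℕ.+ j
  n = suc e
  W : ℕ → ℚω
  W k = Cω n k * Bω (n ∸ k) * (x ^ω k + (- 1#) ^ω k * x ^ω k)
  pair : ∀ k → Cω n k * Bω (n ∸ k) * x ^ω k + Cω n k * Bω (n ∸ k) * (- x) ^ω k ≡ W k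
  pair k = trans (cong (λ z → Cω n k * Bω (n ∸ k) * x ^ω k + Cω n k * Bω (n ∸ k) * z) (^ω-neg x k))
                 (solve 4 (λ c y p t → c :* y :* p :+ c :* y :* (t :* p) := c :* y :* (p :+ t :* p)) refl (Cω n k) (Bω (n ∸ k)) (x ^ω k) ((- 1#) ^ω k))
  W≡0 : ∀ k → k < suc n → k ≢ e → Parity k → W k ≡ 0#
  W≡0 .(suc (i ℕ.+ i)) _ _ (odd i) =
    trans (cong (λ z → Cω n k * Bω (n ∸ k) * (x ^ω k + z * x ^ω k)) ([-1]^[1+j+j]≡-1 i))
          (solve 3 (λ c y p → c :* y :* (p :+ :- con 1# :* p) := con 0#) refl (Cω n k) (Bω (n ∸ k)) (x ^ω k))
    where k = suc (i ℕ.+ i)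
  W≡0 .(i ℕ.+ i) k<1+n k≢e (even i) =
    trans (cong (λ z → Cω n k * z * (x ^ω k + (- 1#) ^ω k * x ^ω k))
                (trans (cong Bω ([1+2j]∸2i≡1+2[j∸i] (ℕP.<⇒≤ i<j))) (bernoulli-odd (ℕP.m<n⇒0<n∸m i<j))))
          (solve 2 (λ c q → c :* con 0# :* q := con 0#) refl (Cω n k) (x ^ω k + (- 1#) ^ω k * x ^ω k))
    where
    k = i ℕ.+ i
    2i<2[1+j] : i ℕ.+ i < suc j ℕ.+ suc j
    2i<2[1+j] = subst (i ℕ.+ i <_) (cong suc (sym (ℕP.+-suc j j))) k<1+n
    i<j : i < j
    i<j = ℕP.≤∧≢⇒< (ℕP.≤-pred (m+m<n+n⇒m<n i (suc j) 2i<2[1+j])) (λ i≡j → k≢e (cong (λ z → z ℕ.+ z) i≡j))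
  W[e] : W e ≡ - (ℕ→ℚω n * x ^ω e)
  W[e] = begin
    Cω n e * Bω (n ∸ e) * (x ^ω e + (- 1#) ^ω e * x ^ω e)  ≡⟨ cong₂ (λ c z → c * Bω (n ∸ e) * (x ^ω e + z * x ^ω e)) (Cω[1+n]n≡1+n e) ([-1]^[j+j]≡1 j) ⟩
    ℕ→ℚω n * Bω (n ∸ e) * (x ^ω e + 1# * x ^ω e)           ≡⟨ cong (λ z → ℕ→ℚω n * Bω z * (x ^ω e + 1# * x ^ω e)) (ℕP.m+n∸n≡m 1 e) ⟩
    ℕ→ℚω n * Bω 1 * (x ^ω e + 1# * x ^ω e)                 ≡⟨ solve 2 (λ m p → m :* con (Bω 1) :* (p :+ con 1# :* p) := :- (m :* p)) refl (ℕ→ℚω n) (x ^ω e) ⟩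
    - (ℕ→ℚω n * x ^ω e)                                    ∎

-- Sixth roots of unity

-- ζ = 1 + ω = -ω² is a primitive sixth root of unity.
ζ : ℚω
ζ = mkω 1ℚ 1ℚ

^ω-periodic : ∀ ε → ε ^ω 6 ≡ 1# → ∀ k → ε ^ω suc (suc (suc (suc (suc (suc k))))) ≡ ε ^ω k
^ω-periodic ε ε⁶≡1 k = trans (^ω-distribˡ-+-* ε 6 k) (trans (cong (_* ε ^ω k) ε⁶≡1) (*-identityˡ (ε ^ω k)))

-- The sixth roots of unity are ζ^i for i < 6, listed here in the order i = 0 … 5 and weighted by ζ^(3i) = ±1,
-- so that χ k = Σ_i ζ^(i(k+3)).
χ : ℕ → ℚω
χ k = 1# ^ω k - ζ ^ω k + ω ^ω k - (- 1#) ^ω k + (- ζ) ^ω k - (- ω) ^ω k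

χ-cong : ∀ k l → (∀ ε → ε ^ω 6 ≡ 1# → ε ^ω k ≡ ε ^ω l) → χ k ≡ χ l
χ-cong k l same-power =
  cong₂ _-_ (cong₂ _+_ (cong₂ _-_ (cong₂ _+_ (cong₂ _-_ (same-power 1# refl) (same-power ζ refl)) (same-power ω refl))
                                  (same-power (- 1#) refl))
                       (same-power (- ζ) refl))
            (same-power (- ω) refl)

χ≡6[k≡3] : ∀ k → χ k ≡ (if does (k % 6 ℕ.≟ 3) then ℕ→ℚω 6 else 0#)
χ≡6[k≡3] 0 = refl
χ≡6[k≡3] 1 = refl
χ≡6[k≡3] 2 = refl
χ≡6[k≡3] 3 = refl
χ≡6[k≡3] 4 = refl
χ≡6[k≡3] 5 = refl
χ≡6[k≡3] (suc (suc (suc (suc (suc (suc k)))))) = trans (χ-cong (suc (suc (suc (suc (suc (suc k)))))) k (λ ε ε⁶≡1 → ^ω-periodic ε ε⁶≡1 k)) (χ≡6[k≡3] k)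

Ω : ℕ → ℚω
Ω e = 1# - ζ ^ω e - ω ^ω e

Ω-cong : ∀ k l → (∀ ε → ε ^ω 6 ≡ 1# → ε ^ω k ≡ ε ^ω l) → Ω k ≡ Ω l
Ω-cong k l same-power = cong₂ _-_ (cong (λ z → 1# - z) (same-power ζ refl)) (same-power ω refl)

Ω[j+j] : ∀ j → Ω (j ℕ.+ j) ≡ (if does (3 ∣? (j ℕ.+ j)) then - 1# else 1# + 1#)
Ω[j+j] 0 = refl
Ω[j+j] 1 = refl
Ω[j+j] 2 = refl
Ω[j+j] (suc (suc (suc j))) = subst (λ e → Ω e ≡ (if does (3 ∣? e) then - 1# else 1# + 1#)) (sym 2[3+j]≡6+2j)
  (trans (Ω-cong (suc (suc (suc (suc (suc (suc (j ℕ.+ j))))))) (j ℕ.+ j) (λ ε ε⁶≡1 → ^ω-periodic ε ε⁶≡1 (j ℕ.+ j))) (Ω[j+j] j))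
  where
  2[3+j]≡6+2j : suc (suc (suc j)) ℕ.+ suc (suc (suc j)) ≡ suc (suc (suc (suc (suc (suc (j ℕ.+ j))))))
  2[3+j]≡6+2j = cong (suc ∘ suc ∘ suc) (trans (ℕP.+-suc j (suc (suc j))) (cong suc (trans (ℕP.+-suc j (suc j)) (cong suc (ℕP.+-suc j j)))))

rootFilter : (ℚω → ℚω) → ℚω → ℚω
rootFilter F y = F (y * 1#) - F (y * ζ) + F (y * ω) - F (y * - 1#) + F (y * - ζ) - F (y * - ω)

rootFilter-monomial : ∀ c y k → rootFilter (λ x → c * x ^ω k) y ≡ χ k * (c * y ^ω k)
rootFilter-monomial c y k = begin
  rootFilter (λ x → c * x ^ω k) y
    ≡⟨ cong₂ _-_ (cong₂ _+_ (cong₂ _-_ (cong₂ _+_ (cong₂ _-_ (split 1#) (split ζ)) (split ω)) (split (- 1#))) (split (- ζ))) (split (- ω)) ⟩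
  c * (y ^ω k * 1# ^ω k) - c * (y ^ω k * ζ ^ω k) + c * (y ^ω k * ω ^ω k) - c * (y ^ω k * (- 1#) ^ω k)
    + c * (y ^ω k * (- ζ) ^ω k) - c * (y ^ω k * (- ω) ^ω k)
    ≡⟨ solve 8 (λ c p e₀ e₁ e₂ e₃ e₄ e₅ →
                 c :* (p :* e₀) :- c :* (p :* e₁) :+ c :* (p :* e₂) :- c :* (p :* e₃) :+ c :* (p :* e₄) :- c :* (p :* e₅)
              := (e₀ :- e₁ :+ e₂ :- e₃ :+ e₄ :- e₅) :* (c :* p))
             refl c (y ^ω k) (1# ^ω k) (ζ ^ω k) (ω ^ω k) ((- 1#) ^ω k) ((- ζ) ^ω k) ((- ω) ^ω k) ⟩
  χ k * (c * y ^ω k) ∎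
  where
  open ≡-Reasoning
  split : ∀ ε → c * (y * ε) ^ω k ≡ c * (y ^ω k * ε ^ω k)
  split ε = cong (c *_) (^ω-distribʳ-* y ε k)

Σω-rootFilter : ∀ N (G : ℚω → ℕ → ℚω) y → Σω N (λ k → rootFilter (λ x → G x k) y) ≡ rootFilter (λ x → Σω N (G x)) y
Σω-rootFilter N G y =
  trans (Σω-difference N (λ k → g₀ k - g₁ k + g₂ k - g₃ k + g₄ k) g₅) (cong (_- Σω N g₅)
  (trans (Σω-+ N (λ k → g₀ k - g₁ k + g₂ k - g₃ k) g₄) (cong (_+ Σω N g₄)
  (trans (Σω-difference N (λ k → g₀ k - g₁ k + g₂ k) g₃) (cong (_- Σω N g₃)
  (trans (Σω-+ N (λ k → g₀ k - g₁ k) g₂) (cong (_+ Σω N g₂)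
  (Σω-difference N g₀ g₁))))))))
  where
  g₀ g₁ g₂ g₃ g₄ g₅ : ℕ → ℚω
  g₀ = G (y * 1#)
  g₁ = G (y * ζ)
  g₂ = G (y * ω)
  g₃ = G (y * - 1#)
  g₄ = G (y * - ζ)
  g₅ = G (y * - ω)

embed-if : ∀ b {q x} → embed q ≡ x → embed (if b then q else 0ℚ) ≡ (if b then x else 0#)
embed-if true  q≡x = q≡x
embed-if false q≡x = refl

if-as-* : ∀ b {c} x → c ≡ (if b then ℕ→ℚω 6 else 0#) → (if b then x else 0#) ≡ embed (ℤ.+ 1 / 6) * (c * x)
if-as-* true  x refl = solve 1 (λ x → x := con (embed (ℤ.+ 1 / 6)) :* (con (ℕ→ℚω 6) :* x)) refl x
if-as-* false x refl = solve 1 (λ x → con 0# := con (embed (ℤ.+ 1 / 6)) :* (con 0# :* x)) refl x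

lhs≡rootFilter : ∀ m n → embed (lhs m n) ≡ embed (ℤ.+ 1 / 6) * rootFilter (bernoulliPoly n) (ℕ→ℚω m)
lhs≡rootFilter m n = begin
  embed (lhs m n)                                                  ≡⟨ embed-Σ< (suc n) (λ k → if does (k % 6 ℕ.≟ 3) then t k else 0ℚ) ⟩
  Σω (suc n) (λ k → embed (if does (k % 6 ℕ.≟ 3) then t k else 0ℚ)) ≡⟨ Σω-cong (suc n) (λ k _ → embed-if (does (k % 6 ℕ.≟ 3)) (embed-t k)) ⟩
  Σω (suc n) (λ k → if does (k % 6 ℕ.≟ 3) then X k else 0#)        ≡⟨ Σω-cong (suc n) (λ k _ → if-as-* (does (k % 6 ℕ.≟ 3)) (X k) (χ≡6[k≡3] k)) ⟩
  Σω (suc n) (λ k → ⅙ * (χ k * X k))                               ≡⟨ Σω-*ˡ (suc n) ⅙ (λ k → χ k * X k) ⟩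
  ⅙ * Σω (suc n) (λ k → χ k * X k)                                 ≡⟨ cong (⅙ *_) (Σω-cong (suc n) (λ k _ → sym (rootFilter-monomial (Cω n k * Bω (n ∸ k)) M k))) ⟩
  ⅙ * Σω (suc n) (λ k → rootFilter (λ x → Cω n k * Bω (n ∸ k) * x ^ω k) M)
                                                                   ≡⟨ cong (⅙ *_) (Σω-rootFilter (suc n) (λ x k → Cω n k * Bω (n ∸ k) * x ^ω k) M) ⟩
  ⅙ * rootFilter (bernoulliPoly n) M                               ∎
  where
  open ≡-Reasoning
  ⅙ = embed (ℤ.+ 1 / 6)
  M = ℕ→ℚω m
  t : ℕ → ℚ
  t k = ℕ→ℚ (n C k) ℚ.* (ℕ→ℚ m ^ℚ k) ℚ.* bernoulli (n ∸ k)
  X : ℕ → ℚω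
  X k = Cω n k * Bω (n ∸ k) * M ^ω k
  embed-t : ∀ k → embed (t k) ≡ X k
  embed-t k = begin
    embed (t k)                                                ≡⟨ embed-* (ℕ→ℚ (n C k) ℚ.* (ℕ→ℚ m ^ℚ k)) (bernoulli (n ∸ k)) ⟩
    embed (ℕ→ℚ (n C k) ℚ.* (ℕ→ℚ m ^ℚ k)) * Bω (n ∸ k)          ≡⟨ cong (_* Bω (n ∸ k)) (embed-* (ℕ→ℚ (n C k)) (ℕ→ℚ m ^ℚ k)) ⟩
    Cω n k * embed (ℕ→ℚ m ^ℚ k) * Bω (n ∸ k)                   ≡⟨ cong (λ z → Cω n k * z * Bω (n ∸ k)) (embed-^ (ℕ→ℚ m) k) ⟩
    Cω n k * M ^ω k * Bω (n ∸ k)                               ≡⟨ solve 3 (λ c p b → c :* p :* b := c :* b :* p) refl (Cω n k) (M ^ω k) (Bω (n ∸ k)) ⟩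
    X k                                                        ∎

rootFilter-bernoulliPoly-odd : ∀ j y → let n = suc (j ℕ.+ j); e = j ℕ.+ j; P = bernoulliPoly n in
  rootFilter P y ≡ (1# + 1#) * (P y - P (y * ζ) + P (y * ω)) + ℕ→ℚω n * y ^ω e * (1# - ζ ^ω e + ω ^ω e)
rootFilter-bernoulliPoly-odd j y = begin
  rootFilter P y
    ≡⟨ cong₂ (λ a d → a - P (y * ζ) + P (y * ω) - d + P (y * - ζ) - P (y * - ω)) (cong P (*-identityʳ y)) (cong P (-y≡ 1#)) ⟩
  P y - P (y * ζ) + P (y * ω) - P (- (y * 1#)) + P (y * - ζ) - P (y * - ω)
    ≡⟨ cong₂ (λ a b → P y - P (y * ζ) + P (y * ω) - P (- a) + b - P (y * - ω)) (*-identityʳ y) (cong P (-y≡ ζ)) ⟩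
  P y - P (y * ζ) + P (y * ω) - P (- y) + P (- (y * ζ)) - P (y * - ω)
    ≡⟨ cong (λ c → P y - P (y * ζ) + P (y * ω) - P (- y) + P (- (y * ζ)) - c) (cong P (-y≡ ω)) ⟩
  P y - P (y * ζ) + P (y * ω) - P (- y) + P (- (y * ζ)) - P (- (y * ω))
    ≡⟨ cong₂ (λ a b → P y - P (y * ζ) + P (y * ω) - a + b - P (- (y * ω))) (bernoulliPoly-neg j y) (neg ζ) ⟩
  P y - P (y * ζ) + P (y * ω) - (- P y - N * y ^ω e) + (- P (y * ζ) - N * (y ^ω e * ζ ^ω e)) - P (- (y * ω))
    ≡⟨ cong (λ c → P y - P (y * ζ) + P (y * ω) - (- P y - N * y ^ω e) + (- P (y * ζ) - N * (y ^ω e * ζ ^ω e)) - c) (neg ω) ⟩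
  P y - P (y * ζ) + P (y * ω) - (- P y - N * y ^ω e) + (- P (y * ζ) - N * (y ^ω e * ζ ^ω e)) - (- P (y * ω) - N * (y ^ω e * ω ^ω e))
    ≡⟨ solve 7 (λ p p′ p″ n t z w →
                  p :- p′ :+ p″ :- (:- p :- n :* t) :+ (:- p′ :- n :* (t :* z)) :- (:- p″ :- n :* (t :* w))
               := (con 1# :+ con 1#) :* (p :- p′ :+ p″) :+ n :* t :* (con 1# :- z :+ w))
             refl (P y) (P (y * ζ)) (P (y * ω)) N (y ^ω e) (ζ ^ω e) (ω ^ω e) ⟩
  (1# + 1#) * (P y - P (y * ζ) + P (y * ω)) + N * y ^ω e * (1# - ζ ^ω e + ω ^ω e) ∎
  where
  open ≡-Reasoning
  n = suc (j ℕ.+ j)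
  e = j ℕ.+ j
  N = ℕ→ℚω n
  P = bernoulliPoly n
  -y≡ : ∀ ε → y * - ε ≡ - (y * ε)
  -y≡ ε = solve 2 (λ y ε → y :* :- ε := :- (y :* ε)) refl y ε
  neg : ∀ ε → P (- (y * ε)) ≡ - P (y * ε) - N * (y ^ω e * ε ^ω e)
  neg ε = trans (bernoulliPoly-neg j (y * ε)) (cong (λ z → - P (y * ε) - N * z) (^ω-distribʳ-* y ε e))

lhs-as-powerSums : ∀ j m → 1 ≤ j → let n = suc (j ℕ.+ j); e = j ℕ.+ j; M = ℕ→ℚω m in
  embed (lhs m n) ≡ embed (ℤ.+ n / 3) * (Σω m (λ r → ℕ→ℚω r ^ω e) - Σω m (λ r → (ℕ→ℚω r + M * ω) ^ω e)
                                         + M ^ω e * embed (ℤ.+ 1 / 2) * (1# - ζ ^ω e + ω ^ω e))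
lhs-as-powerSums j m 1≤j = begin
  embed (lhs m n)                                                     ≡⟨ lhs≡rootFilter m n ⟩
  ⅙ * rootFilter P M                                                  ≡⟨ cong (⅙ *_) (rootFilter-bernoulliPoly-odd j M) ⟩
  ⅙ * ((1# + 1#) * (P M - P (M * ζ) + P (M * ω)) + N * M ^ω e * c)    ≡⟨ cong₂ (λ a b → ⅙ * ((1# + 1#) * (a - b + P (M * ω)) + N * M ^ω e * c)) P[M] P[Mζ] ⟩
  ⅙ * ((1# + 1#) * (N * Σ₁ - (P (M * ω) + N * Σ₂) + P (M * ω)) + N * M ^ω e * c)
    ≡⟨ solve 6 (λ n s₁ s₂ p t c → con ⅙ :* ((con 1# :+ con 1#) :* (n :* s₁ :- (p :+ n :* s₂) :+ p) :+ n :* t :* c)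
                                := n :* con ⅓ :* (s₁ :- s₂ :+ t :* con ½ :* c))
             refl N Σ₁ Σ₂ (P (M * ω)) (M ^ω e) c ⟩
  N * ⅓ * (Σ₁ - Σ₂ + M ^ω e * ½ * c)                                  ≡⟨ cong (λ z → z * (Σ₁ - Σ₂ + M ^ω e * ½ * c)) n/3 ⟨
  embed (ℤ.+ n / 3) * (Σ₁ - Σ₂ + M ^ω e * ½ * c)                      ∎
  where
  open ≡-Reasoning
  n = suc (j ℕ.+ j)
  e = j ℕ.+ j
  N = ℕ→ℚω n
  M = ℕ→ℚω m
  P = bernoulliPoly n
  ⅙ = embed (ℤ.+ 1 / 6)
  ⅓ = embed (ℤ.+ 1 / 3)
  ½ = embed (ℤ.+ 1 / 2)
  c = 1# - ζ ^ω e + ω ^ω e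
  Σ₁ = Σω m (λ r → ℕ→ℚω r ^ω e)
  Σ₂ = Σω m (λ r → (ℕ→ℚω r + M * ω) ^ω e)
  n/3 : embed (ℤ.+ n / 3) ≡ N * ⅓
  n/3 = trans (cong embed (n/d≡n*[1/d] n 2)) (embed-* (ℕ→ℚ n) (ℤ.+ 1 / 3))
  P[M] : P M ≡ N * Σ₁
  P[M] = begin
    P M                                        ≡⟨ cong P (+-identityˡ M) ⟨
    P (0# + M)                                 ≡⟨ bernoulliPoly-+ℕ n 0# m ⟩
    P 0# + N * Σω m (λ r → (0# + ℕ→ℚω r) ^ω e)  ≡⟨ cong₂ (λ a b → a + N * b) (trans (bernoulliPoly-0 n) (bernoulli-odd 1≤j))
                                                                           (Σω-cong m (λ r _ → cong (_^ω e) (+-identityˡ (ℕ→ℚω r)))) ⟩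
    0# + N * Σ₁                                ≡⟨ +-identityˡ (N * Σ₁) ⟩
    N * Σ₁                                     ∎
  P[Mζ] : P (M * ζ) ≡ P (M * ω) + N * Σ₂
  P[Mζ] = begin
    P (M * ζ)                                              ≡⟨ cong P (solve 1 (λ x → x :* con ζ := x :* con ω :+ x) refl M) ⟩
    P (M * ω + M)                                          ≡⟨ bernoulliPoly-+ℕ n (M * ω) m ⟩
    P (M * ω) + N * Σω m (λ r → (M * ω + ℕ→ℚω r) ^ω e)      ≡⟨ cong (λ z → P (M * ω) + N * z) (Σω-cong m (λ r _ → cong (_^ω e) (+-comm (M * ω) (ℕ→ℚω r)))) ⟩
    P (M * ω) + N * Σ₂                                     ∎

term : ℕ → ℕ → ℕ → ℚω
term m n r = (ℕ→ℚω r + ℕ→ℚω m * ω) ^ω (n ∸ 1) + (ℕ→ℚω r + ℕ→ℚω m * (ω * ω)) ^ω (n ∸ 1)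

powerSum : ℕ → ℕ → ℚ
powerSum m e = Σ< m (λ r → if does (r ℕ.≟ 0) then 0ℚ else ℕ→ℚ r ^ℚ e)

rhsΣ : ℕ → ℕ → ℕ → ℚω
rhsΣ m n K = embed (ℤ.+ n / 3) * (embed (powerSum m (n ∸ 1)) - Σω K (λ r → term m n (suc r)) + embed (δ m n))

embed-powerSum : ∀ m e → embed (powerSum m (suc e)) ≡ Σω m (λ r → ℕ→ℚω r ^ω suc e)
embed-powerSum m e = trans (embed-Σ< m _) (Σω-cong m embed-r^e)
  where
  embed-r^e : ∀ r → r < m → embed (if does (r ℕ.≟ 0) then 0ℚ else ℕ→ℚ r ^ℚ suc e) ≡ ℕ→ℚω r ^ω suc e
  embed-r^e zero    _ = sym (^ω-zeroˡ e)
  embed-r^e (suc r) _ = embed-^ (ℕ→ℚ (suc r)) (suc e)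

[m∸r+mω]^e≡[r+mω²]^e : ∀ j m r → r ≤ m → (ℕ→ℚω (m ∸ r) + ℕ→ℚω m * ω) ^ω (j ℕ.+ j) ≡ (ℕ→ℚω r + ℕ→ℚω m * (ω * ω)) ^ω (j ℕ.+ j)
[m∸r+mω]^e≡[r+mω²]^e j m r r≤m = begin
  (ℕ→ℚω (m ∸ r) + M * ω) ^ω (j ℕ.+ j)              ≡⟨ cong (λ z → (z + M * ω) ^ω (j ℕ.+ j)) (ℕ→ℚω-∸ r≤m) ⟩
  (M - R + M * ω) ^ω (j ℕ.+ j)                     ≡⟨ cong (_^ω (j ℕ.+ j)) (solve 2 (λ x y → x :- y :+ x :* con ω := :- (y :+ x :* con (ω * ω))) refl M R) ⟩
  (- (R + M * (ω * ω))) ^ω (j ℕ.+ j)               ≡⟨ ^ω-neg (R + M * (ω * ω)) (j ℕ.+ j) ⟩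
  (- 1#) ^ω (j ℕ.+ j) * (R + M * (ω * ω)) ^ω (j ℕ.+ j)  ≡⟨ cong (_* (R + M * (ω * ω)) ^ω (j ℕ.+ j)) ([-1]^[j+j]≡1 j) ⟩
  1# * (R + M * (ω * ω)) ^ω (j ℕ.+ j)              ≡⟨ *-identityˡ _ ⟩
  (R + M * (ω * ω)) ^ω (j ℕ.+ j)                   ∎
  where
  open ≡-Reasoning
  M = ℕ→ℚω m
  R = ℕ→ℚω r

embed-δ-first : ∀ j m → let e = j ℕ.+ j in
  embed (if does (3 ∣? e) then ℚ.- ((ℤ.+ 1 / 2) ℚ.* (ℕ→ℚ m ^ℚ e)) else ℕ→ℚ m ^ℚ e) ≡ ℕ→ℚω m ^ω e * embed (ℤ.+ 1 / 2) * Ω e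
embed-δ-first j m = trans (by-case (does (3 ∣? (j ℕ.+ j))) (Ω[j+j] j))
                          (cong (λ z → z * embed (ℤ.+ 1 / 2) * Ω (j ℕ.+ j)) (embed-^ (ℕ→ℚ m) (j ℕ.+ j)))
  where
  t = ℕ→ℚ m ^ℚ (j ℕ.+ j)
  by-case : ∀ b {x} → x ≡ (if b then - 1# else 1# + 1#) → embed (if b then ℚ.- ((ℤ.+ 1 / 2) ℚ.* t) else t) ≡ embed t * embed (ℤ.+ 1 / 2) * x
  by-case true  refl = trans (cong -_ (embed-* (ℤ.+ 1 / 2) t))
                             (solve 1 (λ x → :- (con (embed (ℤ.+ 1 / 2)) :* x) := x :* con (embed (ℤ.+ 1 / 2)) :* :- con 1#) refl (embed t))
  by-case false refl = solve 1 (λ x → x := x :* con (embed (ℤ.+ 1 / 2)) :* (con 1# :+ con 1#)) refl (embed t)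

if-odd : ∀ m → m % 2 ≡ 1 → ∀ {A : Set} (x y : A) → (if does (m % 2 ℕ.≟ 1) then x else y) ≡ x
if-odd m m%2≡1 x y = cong (λ r → if does (r ℕ.≟ 1) then x else y) m%2≡1

if-even : ∀ m → m % 2 ≡ 0 → ∀ {A : Set} (x y : A) → (if does (m % 2 ℕ.≟ 1) then x else y) ≡ y
if-even m m%2≡0 x y = cong (λ r → if does (r ℕ.≟ 1) then x else y) m%2≡0

embed-δ-odd : ∀ j K → let m = suc (K ℕ.+ K); e = j ℕ.+ j in embed (δ m (suc e)) ≡ ℕ→ℚω m ^ω e * embed (ℤ.+ 1 / 2) * Ω e
embed-δ-odd j K = begin
  embed (δ m n)           ≡⟨ cong (λ z → embed (F ℚ.- z)) (if-odd m ([1+j+j]%2≡1 K) 0ℚ Z) ⟩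
  embed (F ℚ.- 0ℚ)        ≡⟨ cong embed (ℚP.+-identityʳ F) ⟩
  embed F                 ≡⟨ embed-δ-first j m ⟩
  ℕ→ℚω m ^ω (j ℕ.+ j) * embed (ℤ.+ 1 / 2) * Ω (j ℕ.+ j) ∎
  where
  open ≡-Reasoning
  m = suc (K ℕ.+ K)
  n = suc (j ℕ.+ j)
  F = if does (3 ∣? (n ∸ 1)) then ℚ.- ((ℤ.+ 1 / 2) ℚ.* (ℕ→ℚ m ^ℚ (n ∸ 1))) else ℕ→ℚ m ^ℚ (n ∸ 1)
  Z = ((ℤ.- (ℤ.+ 3) / 1) ^ℚ ((n ∸ 1) ℕ./ 2)) ℚ.* ((ℤ.+ m / 2) ^ℚ (n ∸ 1))

embed-δ-even : ∀ j K → let m = suc (suc (K ℕ.+ K)); e = j ℕ.+ j in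
  embed (δ m (suc e)) ≡ ℕ→ℚω m ^ω e * embed (ℤ.+ 1 / 2) * Ω e - (ℕ→ℚω (suc K) + ℕ→ℚω m * ω) ^ω e
embed-δ-even j K = begin
  embed (δ m n)           ≡⟨ cong (λ z → embed (F ℚ.- z)) (if-even m ([j+j]%2≡0 K) 0ℚ Z) ⟩
  embed (F ℚ.- Z)         ≡⟨ cong₂ _-_ (embed-δ-first j m) correction ⟩
  ℕ→ℚω m ^ω e * embed (ℤ.+ 1 / 2) * Ω e - (q + ℕ→ℚω m * ω) ^ω e ∎
  where
  open ≡-Reasoning
  m = suc (suc (K ℕ.+ K))
  e = j ℕ.+ j
  n = suc e
  q = ℕ→ℚω (suc K)
  [-3] = ℤ.- (ℤ.+ 3) / 1
  F = if does (3 ∣? (n ∸ 1)) then ℚ.- ((ℤ.+ 1 / 2) ℚ.* (ℕ→ℚ m ^ℚ (n ∸ 1))) else ℕ→ℚ m ^ℚ (n ∸ 1)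
  Z = ([-3] ^ℚ ((n ∸ 1) ℕ./ 2)) ℚ.* ((ℤ.+ m / 2) ^ℚ (n ∸ 1))
  -- x * x computes to -3.
  x = 1# + (1# + 1#) * ω
  m≡q+q : ℕ→ℚω m ≡ q + q
  m≡q+q = trans (cong ℕ→ℚω (cong suc (sym (ℕP.+-suc K K)))) (ℕ→ℚω-+ (suc K) (suc K))
  m/2≡1+K : ℤ.+ m / 2 ≡ ℕ→ℚ (suc K)
  m/2≡1+K = begin
    ℤ.+ m / 2                                       ≡⟨ n/d≡n*[1/d] m 1 ⟩
    ℕ→ℚ m ℚ.* (ℤ.+ 1 / 2)                           ≡⟨ cong (λ z → ℕ→ℚ z ℚ.* (ℤ.+ 1 / 2)) (cong suc (sym (ℕP.+-suc K K))) ⟩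
    ℕ→ℚ (suc K ℕ.+ suc K) ℚ.* (ℤ.+ 1 / 2)           ≡⟨ cong (ℚ._* (ℤ.+ 1 / 2)) (ℕ→ℚ-+ (suc K) (suc K)) ⟩
    (ℕ→ℚ (suc K) ℚ.+ ℕ→ℚ (suc K)) ℚ.* (ℤ.+ 1 / 2)   ≡⟨ Q.solve 1 (λ a → (a Q.:+ a) Q.:* Q.con (ℤ.+ 1 / 2) Q.:= a) refl (ℕ→ℚ (suc K)) ⟩
    ℕ→ℚ (suc K)                                     ∎
    where module Q = ℚ-Solver.+-*-Solver
  correction : embed Z ≡ (q + ℕ→ℚω m * ω) ^ω e
  correction = begin
    embed Z                                               ≡⟨ embed-* ([-3] ^ℚ (e ℕ./ 2)) ((ℤ.+ m / 2) ^ℚ e) ⟩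
    embed ([-3] ^ℚ (e ℕ./ 2)) * embed ((ℤ.+ m / 2) ^ℚ e)  ≡⟨ cong₂ _*_ (embed-^ [-3] (e ℕ./ 2)) (embed-^ (ℤ.+ m / 2) e) ⟩
    embed [-3] ^ω (e ℕ./ 2) * embed (ℤ.+ m / 2) ^ω e      ≡⟨ cong₂ (λ a c → embed [-3] ^ω a * embed c ^ω e) ([j+j]/2≡j j) m/2≡1+K ⟩
    (x * x) ^ω j * q ^ω e                                 ≡⟨ cong (_* q ^ω e) (^ω-distribʳ-* x x j) ⟩
    x ^ω j * x ^ω j * q ^ω e                              ≡⟨ cong (_* q ^ω e) (^ω-distribˡ-+-* x j j) ⟨
    x ^ω e * q ^ω e                                       ≡⟨ *-comm (x ^ω e) (q ^ω e) ⟩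
    q ^ω e * x ^ω e                                       ≡⟨ ^ω-distribʳ-* q x e ⟨
    (q * x) ^ω e                                          ≡⟨ cong (_^ω e) (solve 1 (λ y → y :* con x := y :+ (y :+ y) :* con ω) refl q) ⟩
    (q + (q + q) * ω) ^ω e                                ≡⟨ cong (λ z → (q + z * ω) ^ω e) m≡q+q ⟨
    (q + ℕ→ℚω m * ω) ^ω e                                 ∎

lhs≡rhsΣ-by-fold : ∀ j m K mid → 1 ≤ j → let n = suc (j ℕ.+ j); e = j ℕ.+ j; M = ℕ→ℚω m; h = λ r → (ℕ→ℚω r + M * ω) ^ω e in
  Σω m h ≡ h 0 + Σω K (λ r → term m n (suc r)) + mid →
  embed (δ m n) ≡ M ^ω e * embed (ℤ.+ 1 / 2) * Ω e - mid →
  embed (lhs m n) ≡ rhsΣ m n K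
lhs≡rhsΣ-by-fold (suc i) m K mid _ fold δ≡ = begin
  embed (lhs m n)                                          ≡⟨ lhs-as-powerSums j m (s≤s z≤n) ⟩
  n/3 * (Σ₁ - Σω m h + M ^ω e * ½ * c)                    ≡⟨ cong (λ z → n/3 * (Σ₁ - z + M ^ω e * ½ * c)) fold ⟩
  n/3 * (Σ₁ - (h 0 + σ + mid) + M ^ω e * ½ * c)           ≡⟨ cong (λ z → n/3 * (Σ₁ - (z + σ + mid) + M ^ω e * ½ * c)) h₀ ⟩
  n/3 * (Σ₁ - (M ^ω e * ω ^ω e + σ + mid) + M ^ω e * ½ * c)
    ≡⟨ cong (n/3 *_) (solve 6 (λ s₁ t w σ d z → s₁ :- (t :* w :+ σ :+ d) :+ t :* con ½ :* (con 1# :- z :+ w)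
                                              := s₁ :- σ :+ (t :* con ½ :* (con 1# :- z :- w) :- d))
                               refl Σ₁ (M ^ω e) (ω ^ω e) σ mid (ζ ^ω e)) ⟩
  n/3 * (Σ₁ - σ + (M ^ω e * ½ * Ω e - mid))               ≡⟨ cong₂ (λ a b → n/3 * (a - σ + b)) (embed-powerSum m (i ℕ.+ suc i)) δ≡ ⟨
  rhsΣ m n K                                              ∎
  where
  open ≡-Reasoning
  j = suc i
  n = suc (j ℕ.+ j)
  e = j ℕ.+ j
  M = ℕ→ℚω m
  h : ℕ → ℚω
  h r = (ℕ→ℚω r + M * ω) ^ω e
  n/3 = embed (ℤ.+ n / 3)
  ½ = embed (ℤ.+ 1 / 2)
  c = 1# - ζ ^ω e + ω ^ω e
  Σ₁ = Σω m (λ r → ℕ→ℚω r ^ω e)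
  σ = Σω K (λ r → term m n (suc r))
  h₀ : h 0 ≡ M ^ω e * ω ^ω e
  h₀ = trans (cong (_^ω e) (+-identityˡ (M * ω))) (^ω-distribʳ-* M ω e)

module _ (j K : ℕ) (1≤j : 1 ≤ j) where
  private
    e = j ℕ.+ j
    h h′ : ℕ → ℕ → ℚω
    h  m r = (ℕ→ℚω r + ℕ→ℚω m * ω) ^ω e
    h′ m r = (ℕ→ℚω r + ℕ→ℚω m * (ω * ω)) ^ω e

  lhs≡rhsΣ-odd : let m = suc (K ℕ.+ K) in embed (lhs m (suc e)) ≡ rhsΣ m (suc e) K
  lhs≡rhsΣ-odd = lhs≡rhsΣ-by-fold j m K 0# 1≤j
    (trans (Σω-fold-odd K (h m) (h′ m) ([m∸r+mω]^e≡[r+mω²]^e j m)) (sym (+-identityʳ _)))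
    (trans (embed-δ-odd j K) (sym (+-identityʳ _)))
    where m = suc (K ℕ.+ K)

  lhs≡rhsΣ-even : let m = suc (suc (K ℕ.+ K)) in embed (lhs m (suc e)) ≡ rhsΣ m (suc e) K
  lhs≡rhsΣ-even = lhs≡rhsΣ-by-fold j m K (h m (suc K)) 1≤j
    (Σω-fold-even K (h m) (h′ m) ([m∸r+mω]^e≡[r+mω²]^e j m))
    (embed-δ-even j K)
    where m = suc (suc (K ℕ.+ K))

lhs≡rhsΣ : ∀ m n K → K ≡ (m ∸ 1) ℕ./ 2 → 1 ≤ m → 3 ≤ n → n % 2 ≡ 1 → embed (lhs m n) ≡ rhsΣ m n K
lhs≡rhsΣ (suc m′) n K K≡ _ = by-parity (parity n) (parity m′) K≡
  where
  by-parity : ∀ {n m′} → Parity n → Parity m′ → K ≡ m′ ℕ./ 2 → 3 ≤ n → n % 2 ≡ 1 → embed (lhs (suc m′) n) ≡ rhsΣ (suc m′) n K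
  by-parity (even j)      _        _  _   n-odd = ⊥-elim (ℕP.0≢1+n (trans (sym ([j+j]%2≡0 j)) n-odd))
  by-parity (odd zero)    _        _  3≤1 _     = ⊥-elim (ℕP.≤⇒≯ 3≤1 (s≤s (s≤s z≤n)))
  by-parity (odd (suc i)) (even L) K≡ _   _     =
    subst (λ K → embed (lhs (suc (L ℕ.+ L)) (suc (suc i ℕ.+ suc i))) ≡ rhsΣ (suc (L ℕ.+ L)) (suc (suc i ℕ.+ suc i)) K)
          (sym (trans K≡ ([j+j]/2≡j L))) (lhs≡rhsΣ-odd (suc i) L (s≤s z≤n))
  by-parity (odd (suc i)) (odd L)  K≡ _   _     =
    subst (λ K → embed (lhs (suc (suc (L ℕ.+ L))) (suc (suc i ℕ.+ suc i))) ≡ rhsΣ (suc (suc (L ℕ.+ L))) (suc (suc i ℕ.+ suc i)) K)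
          (sym (trans K≡ ([1+j+j]/2≡j L))) (lhs≡rhsΣ-even (suc i) L (s≤s z≤n))

lhs[_] : ℚ → ℕ → ℕ → ℚω
lhs[ z ] m n = mkω (Σ< (suc n) (λ k → if does (k % 6 ℕ.≟ 3) then ℕ→ℚ (n C k) ℚ.* (ℕ→ℚ m ^ℚ k) ℚ.* bernoulli (n ∸ k) else z)) z

δ[_] : ℚ → ℕ → ℕ → ℚ
δ[ z ] m n =
  (if does (3 ∣? (n ∸ 1)) then ℚ.- ((ℤ.+ 1 / 2) ℚ.* (ℕ→ℚ m ^ℚ (n ∸ 1))) else ℕ→ℚ m ^ℚ (n ∸ 1))
  ℚ.- (if does (m % 2 ℕ.≟ 1) then z else ((ℤ.- (ℤ.+ 3) / 1) ^ℚ ((n ∸ 1) ℕ./ 2)) ℚ.* ((ℤ.+ m / 2) ^ℚ (n ∸ 1)))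

rhs[_] : ℚ → ℕ → ℕ → ℕ → (ℕ → ℚω) → ℚω
rhs[ z ] m n K σ = mkω (ℤ.+ n / 3) z *ω
  ((mkω (Σ< m (λ r → if does (r ℕ.≟ 0) then z else ℕ→ℚ r ^ℚ (n ∸ 1))) z +ω (-ω σ K)) +ω mkω (δ[ z ] m n) z)

lhs[0ℚ]≡rhs[0ℚ] : ∀ m n K z (σ : ℕ → ℚω) → 0ℚ ≡ z → σ 0 ≡ 0# → (∀ K′ → σ (suc K′) ≡ σ K′ + term m n (suc K′)) →
  embed (lhs m n) ≡ rhsΣ m n K → lhs[ z ] m n ≡ rhs[ z ] m n K σ
lhs[0ℚ]≡rhs[0ℚ] m n K .0ℚ σ refl σ₀ σ-suc lhs≡rhsΣ =
  trans lhs≡rhsΣ (cong (λ s → embed (ℤ.+ n / 3) * (embed (powerSum m (n ∸ 1)) - s + embed (δ m n)))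
                       (sym (Σω-unique (term m n) {σ} σ₀ σ-suc K)))

-- rhs m n is built from a sum defined in its where block, which cannot be referred to by name; σ is
-- that sum, found by unification.  With-abstraction normalises the goal, and once (m ∸ 1) / 2 and 0ℚ
-- are abstracted it matches rhs[ z ] m n K σ (rhs with 0ℚ replaced by z) structurally.
theorem2p2 : (m n : ℕ) → 1 ≤ m → 3 ≤ n → n % 2 ≡ 1 →
    embed (lhs m n) ≡ rhs m n
theorem2p2 m n 1≤m 3≤n n-odd = proof
  where
  σ : ℕ → ℚω
  σ = _
  proof : embed (lhs m n) ≡ rhs m n
  proof with (m ∸ 1) ℕ./ 2 in K≡ | 0ℚ in 0ℚ≡z
  ... | K | z = lhs[0ℚ]≡rhs[0ℚ] m n K z σ 0ℚ≡z refl (λ _ → refl) (lhs≡rhsΣ m n K (sym K≡) 1≤m 3≤n n-odd)
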